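{- For a prime $p$ let $$\mathcal{A}_{1,\mathcal{F}}(p)=\sum_{\substack{t\bmod p\\ p\nmid\Delta(t)}}a_t(p),\qquad a_t(p)=-\sum_{x\bmod p}\left(\frac{x^3-(36t+6)(36t+5)x}{p}\right),\qquad \Delta(t)=64(36t+6)^3(36t+5)^3.$$ Then $\mathcal{A}_{1,\mathcal{F}}(p)=-2p$ if $p\equiv1\bmod4$, and $\mathcal{A}_{1,\mathcal{F}}(p)=0$ otherwise.
   Context: $\left(\frac{\cdot}{p}\right)$ is the Legendre symbol (with value $0$ at multiples of $p$); this is the family of elliptic curves $y^2=x^3-(36T+6)(36T+5)x$ over $\mathbb{Q}(T)$. -}

module Defs where

open import Data.Nat as ℕ using (ℕ; NonZero; _%_)
open import Data.Nat.Divisibility as ℕD using ()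
open import Data.Integer as ℤ using (ℤ; +_; -_; _+_; _*_; _-_; ∣_∣)
open import Data.Integer.DivMod using (_%ℕ_)
open import Data.Integer.Divisibility using (_∣_)
open import Data.List using (List; upTo; foldr; filter)
open import Data.List.Relation.Unary.Any using (any?)
open import Relation.Binary.PropositionalEquality using (_≡_)
open import Relation.Nullary using (Dec; yes; no; ¬?)

IsSquareMod : (p : ℕ) .{{_ : NonZero p}} → ℕ → Set
IsSquareMod p r = Data.List.Relation.Unary.Any.Any (λ y → (y ℕ.* y) % p ≡ r % p) (upTo p)

isSquareMod? : (p : ℕ) .{{_ : NonZero p}} → (r : ℕ) → Dec (IsSquareMod p r)
isSquareMod? p r = any? (λ y → (y ℕ.* y) % p ℕ.≟ r % p) (upTo p)

divℤ? : (p : ℕ) (a : ℤ) → Dec ((+ p) ∣ a)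
divℤ? p a = p ℕD.∣? ∣ a ∣

legendre : ℤ → (p : ℕ) .{{_ : NonZero p}} → ℤ
legendre a p with divℤ? p a
... | yes _ = + 0
... | no _ with isSquareMod? p (a %ℕ p)
...   | yes _ = + 1
...   | no _ = - (+ 1)

sumℤ : List ℤ → ℤ
sumℤ = foldr _+_ (+ 0)

A-coef : ℕ → ℤ
A-coef t = (+ (36 ℕ.* t) + + 6) * (+ (36 ℕ.* t) + + 5)

a[_]_ : ℕ → (p : ℕ) .{{_ : NonZero p}} → ℤ
a[ t ] p = - sumℤ (Data.List.map (λ x → legendre ((+ x) * (+ x) * (+ x) - A-coef t * (+ x)) p) (upTo p))

Δ : ℕ → ℤ
Δ t = + 64 * (u * u * u) * (v * v * v)
  where
    u = + (36 ℕ.* t) + + 6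
    v = + (36 ℕ.* t) + + 5

A₁ : (p : ℕ) .{{_ : NonZero p}} → ℤ
A₁ p = sumℤ (Data.List.map (λ t → a[ t ] p) (filter (λ t → ¬? (divℤ? p (Δ t))) (upTo p)))

{-# OPTIONS --safe #-}
-- Put u = 36t + 6. Then Δ(t) = (4u(u − 1))³, so p ∤ Δ(t) only removes u ≡ 0, 1, where a_t(p) = −Σ χ(x³) = 0
-- anyway; for p ≥ 5 the map t ↦ u permutes the residues, so A₁(p) = Σ_u a(u) with a(u) = −Σ_x χ(x³ − u(u − 1)x).
-- Swapping the sums and completing the square, 4(x² − u² + u) = −((2u − 1)² − (4x² + 1)), reduces the inner sum to
-- the classical Σ_w χ(w² − d) = p·[d ≡ 0] − 1, whence A₁(p) = −χ(−1)·p·Σ_{4x²+1 ≡ 0} χ(x). That sum is empty when −1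
-- is not a square; if i² = −1 its two terms are χ(±i/2) = χ(±2i) = 1 because ±2i = (1 ± i)². Finally −1 is a square
-- iff p ≡ 1 (mod 4): pairing each nonzero square with its inverse leaves only ±1 unpaired, so (p − 1)/2 is congruent
-- to 1 + [−1 is a square] modulo 2.
module Submission where

open import Defs
open import Data.Nat using (ℕ; NonZero; _%_)
open import Data.Nat.Primality using (Prime)
open import Data.Integer using (+_; -_; _*_)
open import Data.Product using (_×_)
open import Relation.Binary.PropositionalEquality using (_≡_; _≢_)

import Data.Nat as ℕ
open import Data.Nat using (_∸_)
import Data.Nat.Properties as ℕP
import Data.Nat.DivMod as ℕ
import Data.Nat.Divisibility as ℕ
open import Data.Nat.Coprimality using (coprime-Bézout; prime⇒coprime)
open import Data.Nat.GCD using (module Bézout)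
open import Data.Nat.Primality using (euclidsLemma; ¬prime[1]; prime?)
open import Data.Integer as ℤ using (ℤ; _+_; _-_; _≤_)
import Data.Integer.Properties as ℤP
open import Data.Integer.DivMod using (_%ℕ_; _/ℕ_; a≡a%ℕn+[a/ℕn]*n; n%ℕd<d)
import Data.Integer.Divisibility as Unsigned
open import Data.Integer.Divisibility.Signed
  using (_∣_; divides; _∣?_; ∣ᵤ⇒∣; ∣⇒∣ᵤ; ∣m⇒∣-m; ∣m∣n⇒∣m+n; ∣n⇒∣m*n; ∣m⇒∣m*n)
open import Data.Integer.Tactic.RingSolver using (solve-∀)
open import Algebra.Properties.Semiring.Sum ℤP.+-*-semiring
  using (sum; ∑-distrib-+; *-distribˡ-sum; *-distribʳ-sum; sum-cong-≗)
open import Data.Bool using (true; false)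
open import Data.Empty using (⊥-elim)
open import Data.Fin using (toℕ)
import Data.Fin.Properties as FinP
open import Data.List using ([]; _∷_; map; filter; upTo; applyUpTo)
import Data.List.Relation.Unary.Any as Any
import Data.List.Relation.Unary.Any.Properties as AnyP
open import Data.Product using (∃; _,_; proj₁; proj₂)
open import Data.Sum as Sum using (_⊎_; inj₁; inj₂; [_,_])
open import Function using (id; _∘_; _⇔_; mk⇔; Equivalence)
open import Level using (0ℓ)
open import Relation.Binary.Bundles using (Setoid)
open import Relation.Binary.Core using (_Preserves_⟶_)
open import Relation.Binary.Definitions using (tri<; tri≈; tri>)
open import Relation.Binary.PropositionalEquality
  using (refl; sym; trans; cong; cong₂; subst; subst₂; module ≡-Reasoning)
import Relation.Binary.Reasoning.Setoid as ≈-Reasoning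
open import Relation.Nullary using (Dec; yes; no; _because_; ¬_; ¬?)
import Relation.Nullary.Decidable as Dec

𝟙 : ∀ {a} {A : Set a} → Dec A → ℤ
𝟙 (true  because _) = + 1
𝟙 (false because _) = + 0

𝟙-yes : ∀ {A : Set} (d : Dec A) → A → 𝟙 d ≡ + 1
𝟙-yes (yes _) _ = refl
𝟙-yes (no ¬a) a = ⊥-elim (¬a a)

𝟙-no : ∀ {A : Set} (d : Dec A) → ¬ A → 𝟙 d ≡ + 0
𝟙-no (yes a) ¬a = ⊥-elim (¬a a)
𝟙-no (no _)  _  = refl

𝟙-¬? : ∀ {A : Set} (d : Dec A) → 𝟙 (¬? d) ≡ + 1 - 𝟙 d
𝟙-¬? (true  because _) = refl
𝟙-¬? (false because _) = refl

𝟙-cong : ∀ {A B : Set} (dA : Dec A) (dB : Dec B) → A ⇔ B → 𝟙 dA ≡ 𝟙 dB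
𝟙-cong (yes _) (yes _) _   = refl
𝟙-cong (yes a) (no ¬b) A⇔B = ⊥-elim (¬b (Equivalence.to A⇔B a))
𝟙-cong (no ¬a) (yes b) A⇔B = ⊥-elim (¬a (Equivalence.from A⇔B b))
𝟙-cong (no _)  (no _)  _   = refl

𝟙-disjoint-⊎ : ∀ {A B C : Set} (dA : Dec A) (dB : Dec B) (dC : Dec C) →
  C ⇔ (A ⊎ B) → (A → ¬ B) → 𝟙 dC ≡ 𝟙 dA + 𝟙 dB
𝟙-disjoint-⊎ (yes a) (yes b) _ _ disj = ⊥-elim (disj a b)
𝟙-disjoint-⊎ (yes a) (no _) dC C⇔A⊎B _ = 𝟙-yes dC (Equivalence.from C⇔A⊎B (inj₁ a))
𝟙-disjoint-⊎ (no _) (yes b) dC C⇔A⊎B _ = 𝟙-yes dC (Equivalence.from C⇔A⊎B (inj₂ b))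
𝟙-disjoint-⊎ (no ¬a) (no ¬b) dC C⇔A⊎B _ = 𝟙-no dC λ c → [ ¬a , ¬b ] (Equivalence.to C⇔A⊎B c)

𝟙-trichotomy : ∀ {P : Set} i j (P? : Dec P) → P ⇔ (i ≡ j) →
  𝟙 (i ℕ.<? j) + 𝟙 (j ℕ.<? i) + 𝟙 P? ≡ + 1
𝟙-trichotomy i j P? P⇔i≡j with ℕP.<-cmp i j
... | tri< i<j i≢j _
  rewrite 𝟙-yes (i ℕ.<? j) i<j | 𝟙-no (j ℕ.<? i) (ℕP.<-asym i<j) | 𝟙-no P? (i≢j ∘ Equivalence.to P⇔i≡j) = refl
... | tri≈ i≮j i≡j j≮i
  rewrite 𝟙-no (i ℕ.<? j) i≮j | 𝟙-no (j ℕ.<? i) j≮i | 𝟙-yes P? (Equivalence.from P⇔i≡j i≡j) = refl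
... | tri> _ i≢j j<i
  rewrite 𝟙-no (i ℕ.<? j) (ℕP.<-asym j<i) | 𝟙-yes (j ℕ.<? i) j<i | 𝟙-no P? (i≢j ∘ Equivalence.to P⇔i≡j) = refl

sumUpTo : ℕ → (ℕ → ℤ) → ℤ
sumUpTo ℕ.zero    f = + 0
sumUpTo (ℕ.suc n) f = f 0 + sumUpTo n (f ∘ ℕ.suc)

sumUpTo≡sum : ∀ n (f : ℕ → ℤ) → sumUpTo n f ≡ sum {n} (λ i → f (toℕ i))
sumUpTo≡sum ℕ.zero    f = refl
sumUpTo≡sum (ℕ.suc n) f = cong (_+_ (f 0)) (sumUpTo≡sum n (f ∘ ℕ.suc))

sumℤ-map-applyUpTo : ∀ n (f : ℕ → ℤ) (g : ℕ → ℕ) →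
  sumℤ (map f (applyUpTo g n)) ≡ sumUpTo n (f ∘ g)
sumℤ-map-applyUpTo ℕ.zero    f g = refl
sumℤ-map-applyUpTo (ℕ.suc n) f g = cong (_+_ (f (g 0))) (sumℤ-map-applyUpTo n f (g ∘ ℕ.suc))

sumℤ-map-filter : ∀ {P : ℕ → Set} (P? : ∀ x → Dec (P x)) (f : ℕ → ℤ) xs →
  sumℤ (map f (filter P? xs)) ≡ sumℤ (map (λ x → 𝟙 (P? x) * f x) xs)
sumℤ-map-filter P? f [] = refl
sumℤ-map-filter P? f (x ∷ xs) with P? x
... | yes _ = cong₂ _+_ (sym (ℤP.*-identityˡ (f x))) (sumℤ-map-filter P? f xs)
... | no _  = trans (sumℤ-map-filter P? f xs) (sym (ℤP.+-identityˡ _))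

sumUpTo-cong : ∀ {n} {f g : ℕ → ℤ} → (∀ {x} → x ℕ.< n → f x ≡ g x) → sumUpTo n f ≡ sumUpTo n g
sumUpTo-cong {n} {f} {g} f≗g = begin
  sumUpTo n f            ≡⟨ sumUpTo≡sum n f ⟩
  sum (f ∘ toℕ {n})      ≡⟨ sum-cong-≗ (λ i → f≗g (FinP.toℕ<n i)) ⟩
  sum (g ∘ toℕ {n})      ≡⟨ sumUpTo≡sum n g ⟨
  sumUpTo n g            ∎
  where open ≡-Reasoning

sumUpTo-+ : ∀ n (f g : ℕ → ℤ) → sumUpTo n (λ x → f x + g x) ≡ sumUpTo n f + sumUpTo n g
sumUpTo-+ n f g = begin
  sumUpTo n (λ x → f x + g x)              ≡⟨ sumUpTo≡sum n (λ x → f x + g x) ⟩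
  sum {n} (λ i → f (toℕ i) + g (toℕ i))    ≡⟨ ∑-distrib-+ {n} (f ∘ toℕ) (g ∘ toℕ) ⟩
  sum (f ∘ toℕ {n}) + sum (g ∘ toℕ {n})    ≡⟨ cong₂ _+_ (sumUpTo≡sum n f) (sumUpTo≡sum n g) ⟨
  sumUpTo n f + sumUpTo n g                ∎
  where open ≡-Reasoning

*-distribˡ-sumUpTo : ∀ n c (f : ℕ → ℤ) → c * sumUpTo n f ≡ sumUpTo n (λ x → c * f x)
*-distribˡ-sumUpTo n c f = begin
  c * sumUpTo n f                ≡⟨ cong (c *_) (sumUpTo≡sum n f) ⟩
  c * sum (f ∘ toℕ {n})          ≡⟨ *-distribˡ-sum {n} c (f ∘ toℕ) ⟩
  sum {n} (λ i → c * f (toℕ i))  ≡⟨ sumUpTo≡sum n (λ x → c * f x) ⟨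
  sumUpTo n (λ x → c * f x)      ∎
  where open ≡-Reasoning

neg-distrib-sumUpTo : ∀ n (f : ℕ → ℤ) → - sumUpTo n f ≡ sumUpTo n (λ x → - f x)
neg-distrib-sumUpTo ℕ.zero    f = refl
neg-distrib-sumUpTo (ℕ.suc n) f =
  trans (ℤP.neg-distrib-+ (f 0) _) (cong (_+_ (- f 0)) (neg-distrib-sumUpTo n (f ∘ ℕ.suc)))

*-distribʳ-sumUpTo : ∀ n c (f : ℕ → ℤ) → sumUpTo n f * c ≡ sumUpTo n (λ x → f x * c)
*-distribʳ-sumUpTo n c f = begin
  sumUpTo n f * c                ≡⟨ cong (_* c) (sumUpTo≡sum n f) ⟩
  sum (f ∘ toℕ {n}) * c          ≡⟨ *-distribʳ-sum {n} c (f ∘ toℕ) ⟩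
  sum {n} (λ i → f (toℕ i) * c)  ≡⟨ sumUpTo≡sum n (λ x → f x * c) ⟨
  sumUpTo n (λ x → f x * c)      ∎
  where open ≡-Reasoning

sumUpTo-const : ∀ n c → sumUpTo n (λ _ → c) ≡ + n * c
sumUpTo-const ℕ.zero    c = sym (ℤP.*-zeroˡ c)
sumUpTo-const (ℕ.suc n) c = begin
  c + sumUpTo n (λ _ → c) ≡⟨ cong (_+_ c) (sumUpTo-const n c) ⟩
  c + + n * c             ≡⟨ cong (_+ + n * c) (ℤP.*-identityˡ c) ⟨
  + 1 * c + + n * c       ≡⟨ ℤP.*-distribʳ-+ c (+ 1) (+ n) ⟨
  + ℕ.suc n * c           ∎
  where open ≡-Reasoning

sumUpTo-zero : ∀ n → sumUpTo n (λ _ → + 0) ≡ + 0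
sumUpTo-zero n = trans (sumUpTo-const n (+ 0)) (ℤP.*-zeroʳ (+ n))

sumUpTo-comm : ∀ n m (f : ℕ → ℕ → ℤ) →
  sumUpTo n (λ x → sumUpTo m (f x)) ≡ sumUpTo m (λ y → sumUpTo n (λ x → f x y))
sumUpTo-comm ℕ.zero    m f = sym (sumUpTo-zero m)
sumUpTo-comm (ℕ.suc n) m f =
  trans (cong (_+_ (sumUpTo m (f 0))) (sumUpTo-comm n m (f ∘ ℕ.suc))) (sym (sumUpTo-+ m (f 0) _))

sumUpTo-nonpositive : ∀ n {f : ℕ → ℤ} → (∀ {x} → x ℕ.< n → f x ≤ + 0) → sumUpTo n f ≤ + 0
sumUpTo-nonpositive ℕ.zero    f≤0 = ℤP.≤-refl
sumUpTo-nonpositive (ℕ.suc n) f≤0 =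
  ℤP.+-mono-≤ (f≤0 (ℕ.s≤s ℕ.z≤n)) (sumUpTo-nonpositive n (f≤0 ∘ ℕ.s≤s))

nonpositive-+-≡0ˡ : ∀ {a b} → a ≤ + 0 → b ≤ + 0 → a + b ≡ + 0 → a ≡ + 0
nonpositive-+-≡0ˡ {a} {b} a≤0 b≤0 a+b≡0 = ℤP.≤-antisym a≤0 0≤a
  where
  0≤a : + 0 ≤ a
  0≤a = subst₂ _≤_ a+b≡0 (ℤP.+-identityʳ a) (ℤP.+-monoʳ-≤ a b≤0)

sumUpTo-nonpositive-≡0 : ∀ n {f : ℕ → ℤ} → (∀ {x} → x ℕ.< n → f x ≤ + 0) →
  sumUpTo n f ≡ + 0 → ∀ {x} → x ℕ.< n → f x ≡ + 0
sumUpTo-nonpositive-≡0 (ℕ.suc n) {f} f≤0 Σ≡0 {ℕ.zero} _ =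
  nonpositive-+-≡0ˡ (f≤0 (ℕ.s≤s ℕ.z≤n)) (sumUpTo-nonpositive n (f≤0 ∘ ℕ.s≤s)) Σ≡0
sumUpTo-nonpositive-≡0 (ℕ.suc n) {f} f≤0 Σ≡0 {ℕ.suc x} (ℕ.s≤s x<n) =
  sumUpTo-nonpositive-≡0 n (f≤0 ∘ ℕ.s≤s) Σ'≡0 x<n
  where
  Σ'≡0 : sumUpTo n (f ∘ ℕ.suc) ≡ + 0
  Σ'≡0 = nonpositive-+-≡0ˡ (sumUpTo-nonpositive n (f≤0 ∘ ℕ.s≤s)) (f≤0 (ℕ.s≤s ℕ.z≤n))
           (trans (ℤP.+-comm _ (f 0)) Σ≡0)

sumUpTo-δ : ∀ n {c} (f : ℕ → ℤ) → c ℕ.< n → sumUpTo n (λ x → 𝟙 (x ℕ.≟ c) * f x) ≡ f c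
sumUpTo-δ (ℕ.suc n) {ℕ.zero} f _ =
  trans (cong₂ _+_ (ℤP.*-identityˡ (f 0)) (sumUpTo-zero n)) (ℤP.+-identityʳ (f 0))
sumUpTo-δ (ℕ.suc n) {ℕ.suc c} f (ℕ.s≤s c<n) = begin
  𝟙 (0 ℕ.≟ ℕ.suc c) * f 0 + sumUpTo n (λ x → 𝟙 (ℕ.suc x ℕ.≟ ℕ.suc c) * f (ℕ.suc x))
    ≡⟨ cong₂ _+_ (cong (_* f 0) (𝟙-no (0 ℕ.≟ ℕ.suc c) λ ()))
                 (sumUpTo-cong {n} {λ x → 𝟙 (ℕ.suc x ℕ.≟ ℕ.suc c) * f (ℕ.suc x)} {g} λ {x} _ → 𝟙-suc≟suc {x}) ⟩
  + 0 + sumUpTo n g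
    ≡⟨ ℤP.+-identityˡ _ ⟩
  sumUpTo n g
    ≡⟨ sumUpTo-δ n (f ∘ ℕ.suc) c<n ⟩
  f (ℕ.suc c) ∎
  where
  open ≡-Reasoning
  g : ℕ → ℤ
  g x = 𝟙 (x ℕ.≟ c) * f (ℕ.suc x)
  𝟙-suc≟suc : ∀ {x} → 𝟙 (ℕ.suc x ℕ.≟ ℕ.suc c) * f (ℕ.suc x) ≡ g x
  𝟙-suc≟suc {x} =
    cong (_* f (ℕ.suc x)) (𝟙-cong (ℕ.suc x ℕ.≟ ℕ.suc c) (x ℕ.≟ c) (mk⇔ ℕP.suc-injective (cong ℕ.suc)))

module Congruence (m : ℕ) .{{_ : NonZero m}} where

  infix 4 _≈_ _≈?_

  -- A record rather than a synonym for divisibility, so that a and b can be read off a proof of a ≈ b.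
  record _≈_ (a b : ℤ) : Set where
    constructor mk≈
    field m∣a-b : + m ∣ a - b

  open _≈_ public

  _≈?_ : ∀ a b → Dec (a ≈ b)
  a ≈? b = Dec.map′ mk≈ m∣a-b (+ m ∣? a - b)

  ≈-reflexive : ∀ {a b} → a ≡ b → a ≈ b
  ≈-reflexive {a} refl = mk≈ (subst (+ m ∣_) (sym (ℤP.+-inverseʳ a)) (divides (+ 0) refl))

  ≈-refl : ∀ {a} → a ≈ a
  ≈-refl = ≈-reflexive refl

  ≈-sym : ∀ {a b} → a ≈ b → b ≈ a
  ≈-sym {a} {b} (mk≈ m∣a-b) = mk≈ (subst (+ m ∣_) (ring a b) (∣m⇒∣-m m∣a-b))
    where
    ring : ∀ a b → - (a - b) ≡ b - a
    ring = solve-∀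

  ≈-trans : ∀ {a b c} → a ≈ b → b ≈ c → a ≈ c
  ≈-trans {a} {b} {c} (mk≈ m∣a-b) (mk≈ m∣b-c) = mk≈ (subst (+ m ∣_) (ring a b c) (∣m∣n⇒∣m+n m∣a-b m∣b-c))
    where
    ring : ∀ a b c → (a - b) + (b - c) ≡ a - c
    ring = solve-∀

  ≈-setoid : Setoid 0ℓ 0ℓ
  ≈-setoid = record
    { Carrier = ℤ ; _≈_ = _≈_
    ; isEquivalence = record { refl = ≈-refl ; sym = ≈-sym ; trans = ≈-trans } }

  +-cong : ∀ {a a′ b b′} → a ≈ a′ → b ≈ b′ → a + b ≈ a′ + b′
  +-cong {a} {a′} {b} {b′} (mk≈ m∣a-a′) (mk≈ m∣b-b′) =
    mk≈ (subst (+ m ∣_) (ring a a′ b b′) (∣m∣n⇒∣m+n m∣a-a′ m∣b-b′))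
    where
    ring : ∀ a a′ b b′ → (a - a′) + (b - b′) ≡ (a + b) - (a′ + b′)
    ring = solve-∀

  *-cong : ∀ {a a′ b b′} → a ≈ a′ → b ≈ b′ → a * b ≈ a′ * b′
  *-cong {a} {a′} {b} {b′} (mk≈ m∣a-a′) (mk≈ m∣b-b′) =
    mk≈ (subst (+ m ∣_) (ring a a′ b b′) (∣m∣n⇒∣m+n (∣n⇒∣m*n b m∣a-a′) (∣n⇒∣m*n a′ m∣b-b′)))
    where
    ring : ∀ a a′ b b′ → b * (a - a′) + a′ * (b - b′) ≡ a * b - a′ * b′
    ring = solve-∀

  +-congˡ : ∀ a {b b′} → b ≈ b′ → a + b ≈ a + b′
  +-congˡ a = +-cong (≈-refl {a})

  +-congʳ : ∀ b {a a′} → a ≈ a′ → a + b ≈ a′ + b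
  +-congʳ b a≈a′ = +-cong a≈a′ (≈-refl {b})

  *-congˡ : ∀ a {b b′} → b ≈ b′ → a * b ≈ a * b′
  *-congˡ a = *-cong (≈-refl {a})

  *-congʳ : ∀ b {a a′} → a ≈ a′ → a * b ≈ a′ * b
  *-congʳ b a≈a′ = *-cong a≈a′ (≈-refl {b})

  -‿cong : ∀ {a a′} → a ≈ a′ → - a ≈ - a′
  -‿cong {a} {a′} (mk≈ m∣a-a′) = mk≈ (subst (+ m ∣_) (ring a a′) (∣m⇒∣-m m∣a-a′))
    where
    ring : ∀ a a′ → - (a - a′) ≡ - a - - a′
    ring = solve-∀

  𝟙-≈?-cong : ∀ {a a′ b b′} → a ≈ a′ → b ≈ b′ → 𝟙 (a ≈? b) ≡ 𝟙 (a′ ≈? b′)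
  𝟙-≈?-cong a≈a′ b≈b′ = 𝟙-cong _ _ (mk⇔ (λ a≈b → ≈-trans (≈-sym a≈a′) (≈-trans a≈b b≈b′))
                                        (λ a′≈b′ → ≈-trans a≈a′ (≈-trans a′≈b′ (≈-sym b≈b′))))

  𝟙-sym : ∀ a b → 𝟙 (a ≈? b) ≡ 𝟙 (b ≈? a)
  𝟙-sym a b = 𝟙-cong (a ≈? b) (b ≈? a) (mk⇔ ≈-sym ≈-sym)

  ∣⇒≈0 : ∀ {a} → + m ∣ a → a ≈ + 0
  ∣⇒≈0 {a} m∣a = mk≈ (subst (+ m ∣_) (sym (ℤP.+-identityʳ a)) m∣a)

  ≈0⇒∣ : ∀ {a} → a ≈ + 0 → + m ∣ a
  ≈0⇒∣ {a} (mk≈ m∣a-0) = subst (+ m ∣_) (ℤP.+-identityʳ a) m∣a-0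

  ∣-resp-≈ : ∀ {a b} → a ≈ b → + m ∣ a → + m ∣ b
  ∣-resp-≈ a≈b m∣a = ≈0⇒∣ (≈-trans (≈-sym a≈b) (∣⇒≈0 m∣a))

  residue : ℤ → ℕ
  residue a = a %ℕ m

  residue<m : ∀ a → residue a ℕ.< m
  residue<m a = n%ℕd<d a m

  residue-≈ : ∀ a → + residue a ≈ a
  residue-≈ a = mk≈ (divides (- (a /ℕ m)) (ring (+ residue a) a (a /ℕ m) (+ m) (a≡a%ℕn+[a/ℕn]*n a m)))
    where
    ring : ∀ r a q m → a ≡ r + q * m → r - a ≡ - q * m
    ring r a q m refl = lemma r q m
      where
      lemma : ∀ r q m → r - (r + q * m) ≡ - q * m
      lemma = solve-∀

  <m-≈⇒≤ : ∀ {x y} → x ℕ.< m → + x ≈ + y → x ℕ.≤ y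
  <m-≈⇒≤ {x} {y} x<m x≈y with ℕP.≤-total x y
  ... | inj₁ x≤y = x≤y
  ... | inj₂ y≤x = ℕP.m∸n≡0⇒m≤n (begin
    x ∸ y        ≡⟨ ℕ.m<n⇒m%n≡m (ℕP.≤-<-trans (ℕP.m∸n≤m x y) x<m) ⟨
    (x ∸ y) % m  ≡⟨ ℕ.n∣m⇒m%n≡0 (x ∸ y) m (subst (m ℕ.∣_) ∣x-y∣≡x∸y (∣⇒∣ᵤ (m∣a-b x≈y))) ⟩
    0            ∎)
    where
    open ≡-Reasoning
    ∣x-y∣≡x∸y : ℤ.∣ + x - + y ∣ ≡ x ∸ y
    ∣x-y∣≡x∸y = cong ℤ.∣_∣ (trans (ℤP.m-n≡m⊖n x y) (ℤP.⊖-≥ y≤x))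

  residue-unique : ∀ {x y} → x ℕ.< m → y ℕ.< m → + x ≈ + y → x ≡ y
  residue-unique x<m y<m x≈y = ℕP.≤-antisym (<m-≈⇒≤ x<m x≈y) (<m-≈⇒≤ y<m (≈-sym x≈y))

  n≡m*k+r⇒n%m≡r : ∀ {n r} k → + n ≡ + m * k + + r → r ℕ.< m → n % m ≡ r
  n≡m*k+r⇒n%m≡r {n} {r} k n≡mk+r r<m = residue-unique (residue<m (+ n)) r<m
    (≈-trans (residue-≈ (+ n)) (mk≈ (divides k (trans (cong (_- + r) n≡mk+r) (ring (+ m) k (+ r))))))
    where
    ring : ∀ m k r → m * k + r - r ≡ k * m
    ring = solve-∀

  residue-≡⇔≈ : ∀ {a b} → residue a ≡ residue b ⇔ a ≈ b
  residue-≡⇔≈ {a} {b} = mk⇔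
    (λ r≡r → ≈-trans (≈-sym (residue-≈ a)) (≈-trans (≈-reflexive (cong +_ r≡r)) (residue-≈ b)))
    (λ a≈b → residue-unique (residue<m a) (residue<m b)
               (≈-trans (residue-≈ a) (≈-trans a≈b (≈-sym (residue-≈ b)))))

  residue-cong : ∀ {a b} → a ≈ b → residue a ≡ residue b
  residue-cong = Equivalence.from residue-≡⇔≈

  ≈⇒≡residue : ∀ {x a} → x ℕ.< m → + x ≈ a → x ≡ residue a
  ≈⇒≡residue {x} x<m x≈a = trans (sym (ℕ.m<n⇒m%n≡m x<m)) (residue-cong x≈a)

  -- Opaque, so that ∑ ?F unifies with ∑ (λ a → …) by comparing the arguments.
  opaque
    ∑ : (ℤ → ℤ) → ℤ
    ∑ F = sumUpTo m (λ x → F (+ x))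

  opaque
    unfolding ∑

    ∑-cong : ∀ {F G} → (∀ a → F a ≡ G a) → ∑ F ≡ ∑ G
    ∑-cong {F} {G} F≗G = sumUpTo-cong {m} {F ∘ +_} {G ∘ +_} (λ {x} _ → F≗G (+ x))

    ∑-δ : ∀ {F : ℤ → ℤ} c → F Preserves _≈_ ⟶ _≡_ → ∑ (λ y → 𝟙 (y ≈? c) * F y) ≡ F c
    ∑-δ {F} c F-cong = begin
      ∑ (λ y → 𝟙 (y ≈? c) * F y)
        ≡⟨ sumUpTo-cong (λ {y} y<m → cong (_* F (+ y)) (𝟙-cong (+ y ≈? c) (y ℕ.≟ residue c) (≈⇔≡residue y<m))) ⟩
      sumUpTo m (λ y → 𝟙 (y ℕ.≟ residue c) * F (+ y))
        ≡⟨ sumUpTo-δ m (F ∘ +_) (residue<m c) ⟩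
      F (+ residue c)
        ≡⟨ F-cong (residue-≈ c) ⟩
      F c ∎
      where
      open ≡-Reasoning
      ≈⇔≡residue : ∀ {y} → y ℕ.< m → + y ≈ c ⇔ y ≡ residue c
      ≈⇔≡residue y<m = mk⇔ (≈⇒≡residue y<m) (λ { refl → residue-≈ c })

    ∑-count : ∀ c → ∑ (λ y → 𝟙 (y ≈? c)) ≡ + 1
    ∑-count c = trans (∑-cong (λ y → sym (ℤP.*-identityʳ (𝟙 (y ≈? c))))) (∑-δ c (λ _ → refl))

    ∑-+ : ∀ F G → ∑ (λ a → F a + G a) ≡ ∑ F + ∑ G
    ∑-+ F G = sumUpTo-+ m (F ∘ +_) (G ∘ +_)

    *-distribˡ-∑ : ∀ c F → c * ∑ F ≡ ∑ (λ a → c * F a)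
    *-distribˡ-∑ c F = *-distribˡ-sumUpTo m c (F ∘ +_)

    *-distribʳ-∑ : ∀ c F → ∑ F * c ≡ ∑ (λ a → F a * c)
    *-distribʳ-∑ c F = *-distribʳ-sumUpTo m c (F ∘ +_)

    neg-distrib-∑ : ∀ F → - ∑ F ≡ ∑ (λ a → - F a)
    neg-distrib-∑ F = neg-distrib-sumUpTo m (F ∘ +_)

    ∑-const : ∀ c → ∑ (λ _ → c) ≡ + m * c
    ∑-const = sumUpTo-const m

    ∑-comm : ∀ (F : ℤ → ℤ → ℤ) → ∑ (λ a → ∑ (F a)) ≡ ∑ (λ b → ∑ (λ a → F a b))
    ∑-comm F = sumUpTo-comm m m (λ x y → F (+ x) (+ y))

    ∑-nonpositive-≡0 : ∀ {F} → F Preserves _≈_ ⟶ _≡_ → (∀ a → F a ≤ + 0) → ∑ F ≡ + 0 →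
      ∀ a → F a ≡ + 0
    ∑-nonpositive-≡0 {F} F-cong F≤0 ∑F≡0 a =
      trans (F-cong (≈-sym (residue-≈ a)))
            (sumUpTo-nonpositive-≡0 m (λ {x} _ → F≤0 (+ x)) ∑F≡0 (residue<m a))

    ∑≡sumUpTo : ∀ F → ∑ F ≡ sumUpTo m (λ x → F (+ x))
    ∑≡sumUpTo F = refl

  ∑-reindex : ∀ {F g : ℤ → ℤ} (h : ℤ → ℤ) → F Preserves _≈_ ⟶ _≡_ → g Preserves _≈_ ⟶ _≈_ →
    (∀ b → g (h b) ≈ b) → (∀ {a b} → g a ≈ g b → a ≈ b) → ∑ (λ a → F (g a)) ≡ ∑ F
  ∑-reindex {F} {g} h F-cong g-cong g∘h≈id g-injective = begin
    ∑ (λ a → F (g a))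
      ≡⟨ ∑-cong (λ a → ∑-δ (g a) F-cong) ⟨
    ∑ (λ a → ∑ (λ b → 𝟙 (b ≈? g a) * F b))
      ≡⟨ ∑-comm _ ⟩
    ∑ (λ b → ∑ (λ a → 𝟙 (b ≈? g a) * F b))
      ≡⟨ ∑-cong (λ b → *-distribʳ-∑ (F b) _) ⟨
    ∑ (λ b → ∑ (λ a → 𝟙 (b ≈? g a)) * F b)
      ≡⟨ ∑-cong (λ b → cong (_* F b) (trans (∑-cong (λ a → 𝟙-cong _ _ (≈g⇔≈h a b))) (∑-count (h b)))) ⟩
    ∑ (λ b → + 1 * F b)
      ≡⟨ ∑-cong (λ b → ℤP.*-identityˡ (F b)) ⟩
    ∑ F ∎
    where
    open ≡-Reasoning
    ≈g⇔≈h : ∀ a b → b ≈ g a ⇔ a ≈ h b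
    ≈g⇔≈h a b = mk⇔ (λ b≈ga → g-injective (≈-trans (≈-sym b≈ga) (≈-sym (g∘h≈id b))))
                    (λ a≈hb → ≈-sym (≈-trans (g-cong a≈hb) (g∘h≈id b)))

  ∑-involution : ∀ {F g : ℤ → ℤ} → F Preserves _≈_ ⟶ _≡_ → g Preserves _≈_ ⟶ _≈_ →
    (∀ a → g (g a) ≈ a) → ∑ (λ a → F (g a)) ≡ ∑ F
  ∑-involution {F} {g} F-cong g-cong g∘g≈id = ∑-reindex g F-cong g-cong g∘g≈id g-injective
    where
    g-injective : ∀ {a b} → g a ≈ g b → a ≈ b
    g-injective {a} {b} ga≈gb = ≈-trans (≈-sym (g∘g≈id a)) (≈-trans (g-cong ga≈gb) (g∘g≈id b))

  ∑-involution-parity : ∀ {F g : ℤ → ℤ} → F Preserves _≈_ ⟶ _≡_ → g Preserves _≈_ ⟶ _≈_ →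
    (∀ a → g (g a) ≈ a) → (∀ a → F (g a) ≡ F a) →
    ∃ λ X → ∑ F ≡ + 2 * X + ∑ (λ a → 𝟙 (g a ≈? a) * F a)
  ∑-involution-parity {F} {g} F-cong g-cong g∘g≈id F∘g≗F = ∑ below , (begin
    ∑ F
      ≡⟨ ∑-cong split ⟩
    ∑ (λ a → below a + above a + fixed a)
      ≡⟨ trans (∑-+ _ fixed) (cong (_+ ∑ fixed) (∑-+ below above)) ⟩
    ∑ below + ∑ above + ∑ fixed
      ≡⟨ cong (λ s → ∑ below + s + ∑ fixed) ∑above≡∑below ⟩
    ∑ below + ∑ below + ∑ fixed
      ≡⟨ cong (_+ ∑ fixed) (double (∑ below)) ⟩
    + 2 * ∑ below + ∑ fixed ∎)
    where
    open ≡-Reasoning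
    below above fixed : ℤ → ℤ
    below a = 𝟙 (residue a ℕ.<? residue (g a)) * F a
    above a = 𝟙 (residue (g a) ℕ.<? residue a) * F a
    fixed a = 𝟙 (g a ≈? a) * F a

    split : ∀ a → F a ≡ below a + above a + fixed a
    split a = begin
      F a               ≡⟨ ℤP.*-identityˡ (F a) ⟨
      + 1 * F a         ≡⟨ cong (_* F a) (𝟙-trichotomy (residue a) (residue (g a)) (g a ≈? a) fixed⇔≡) ⟨
      (i + j + k) * F a ≡⟨ distrib i j k (F a) ⟩
      below a + above a + fixed a ∎
      where
      i = 𝟙 (residue a ℕ.<? residue (g a))
      j = 𝟙 (residue (g a) ℕ.<? residue a)
      k = 𝟙 (g a ≈? a)
      fixed⇔≡ : g a ≈ a ⇔ residue a ≡ residue (g a)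
      fixed⇔≡ = mk⇔ (residue-cong ∘ ≈-sym) (≈-sym ∘ Equivalence.to residue-≡⇔≈)
      distrib : ∀ i j k f → (i + j + k) * f ≡ i * f + j * f + k * f
      distrib = solve-∀

    ∑above≡∑below : ∑ above ≡ ∑ below
    ∑above≡∑below = begin
      ∑ above              ≡⟨ ∑-involution above-cong g-cong g∘g≈id ⟨
      ∑ (λ a → above (g a)) ≡⟨ ∑-cong above∘g ⟩
      ∑ below              ∎
      where
      above-cong : above Preserves _≈_ ⟶ _≡_
      above-cong a≈b = cong₂ _*_
        (cong₂ (λ i j → 𝟙 (i ℕ.<? j)) (residue-cong (g-cong a≈b)) (residue-cong a≈b)) (F-cong a≈b)
      above∘g : ∀ a → above (g a) ≡ below a
      above∘g a = cong₂ _*_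
        (cong (λ i → 𝟙 (i ℕ.<? residue (g a))) (residue-cong (g∘g≈id a))) (F∘g≗F a)

    double : ∀ x → x + x ≡ + 2 * x
    double = solve-∀

module PrimeField (p : ℕ) .{{_ : NonZero p}} (p-prime : Prime p) where

  open Congruence p public

  p∣*⇒p∣⊎p∣ : ∀ a b → + p ∣ a * b → + p ∣ a ⊎ + p ∣ b
  p∣*⇒p∣⊎p∣ a b p∣ab = Sum.map ∣ᵤ⇒∣ ∣ᵤ⇒∣
    (euclidsLemma ℤ.∣ a ∣ ℤ.∣ b ∣ p-prime (subst (p ℕ.∣_) (ℤP.abs-* a b) (∣⇒∣ᵤ p∣ab)))

  ¬p∣* : ∀ {a b} → ¬ + p ∣ a → ¬ + p ∣ b → ¬ + p ∣ a * b
  ¬p∣* ¬p∣a ¬p∣b = [ ¬p∣a , ¬p∣b ] ∘ p∣*⇒p∣⊎p∣ _ _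

  p∣square⇒p∣ : ∀ {a} → + p ∣ a * a → + p ∣ a
  p∣square⇒p∣ {a} p∣aa = [ id , id ] (p∣*⇒p∣⊎p∣ a a p∣aa)

  p∣cube⇒p∣ : ∀ {a} → + p ∣ a * a * a → + p ∣ a
  p∣cube⇒p∣ {a} p∣aaa = [ p∣square⇒p∣ {a} , id ] (p∣*⇒p∣⊎p∣ (a * a) a p∣aaa)

  ¬p∣0<n<p : ∀ {n} → 0 ℕ.< n → n ℕ.< p → ¬ + p ∣ + n
  ¬p∣0<n<p {ℕ.suc _} _ n<p p∣n = ℕP.<⇒≱ n<p (ℕ.∣⇒≤ (∣⇒∣ᵤ p∣n))

  ¬p∣1 : ¬ + p ∣ + 1
  ¬p∣1 p∣1 = ¬prime[1] (subst Prime (ℕ.∣1⇒≡1 (∣⇒∣ᵤ p∣1)) p-prime)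

  ¬p∣- : ∀ {a} → ¬ + p ∣ a → ¬ + p ∣ - a
  ¬p∣- {a} ¬p∣a = ¬p∣a ∘ subst (+ p ∣_) (ℤP.neg-involutive a) ∘ ∣m⇒∣-m

  ¬p∣-1 : ¬ + p ∣ - + 1
  ¬p∣-1 = ¬p∣- ¬p∣1

  *-cancelˡ-≈ : ∀ {c a b} → ¬ + p ∣ c → c * a ≈ c * b → a ≈ b
  *-cancelˡ-≈ {c} {a} {b} ¬p∣c (mk≈ p∣ca-cb) =
    mk≈ ([ ⊥-elim ∘ ¬p∣c , id ] (p∣*⇒p∣⊎p∣ c (a - b) (subst (+ p ∣_) (ring c a b) p∣ca-cb)))
    where
    ring : ∀ c a b → c * a - c * b ≡ c * (a - b)
    ring = solve-∀

  ∃-inverse : ∀ a → ¬ + p ∣ a → ∃ λ b → a * b ≈ + 1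
  ∃-inverse a ¬p∣a = invert (coprime-Bézout (prime⇒coprime p-prime {{r≢0}} (residue<m a)))
    where
    r = residue a
    r≢0 : NonZero r
    r≢0 = ℕ.≢-nonZero λ r≡0 → ¬p∣a (∣-resp-≈ (residue-≈ a) (subst (+ p ∣_) (cong (+_) (sym r≡0)) (divides (+ 0) refl)))
    lift : ∀ {i j k l} → 1 ℕ.+ i ℕ.* j ≡ k ℕ.* l → + 1 + + i * + j ≡ + k * + l
    lift {i} {j} {k} {l} eq = begin
      + 1 + + i * + j     ≡⟨ cong (_+_ (+ 1)) (ℤP.pos-* i j) ⟨
      + (1 ℕ.+ i ℕ.* j)   ≡⟨ cong (+_) eq ⟩
      + (k ℕ.* l)         ≡⟨ ℤP.pos-* k l ⟩
      + k * + l           ∎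
      where open ≡-Reasoning
    invert : Bézout.Identity 1 p r → ∃ λ b → a * b ≈ + 1
    invert (Bézout.+- x y 1+yr≡xp) = - + y , ≈-trans (*-congʳ (- + y) (≈-sym (residue-≈ a)))
      (mk≈ (divides (- + x) (trans (ring (+ r) (+ y)) (trans (cong -_ (lift {y} {r} {x} {p} 1+yr≡xp)) (ℤP.neg-distribˡ-* (+ x) (+ p))))))
      where
      ring : ∀ r y → r * - y - + 1 ≡ - (+ 1 + y * r)
      ring = solve-∀
    invert (Bézout.-+ x y 1+xp≡yr) = + y , ≈-trans (*-congʳ (+ y) (≈-sym (residue-≈ a)))
      (mk≈ (divides (+ x) (trans (cong (_- + 1) (trans (ℤP.*-comm (+ r) (+ y)) (sym (lift {x} {p} {y} {r} 1+xp≡yr)))) (ring (+ x * + p)))))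
      where
      ring : ∀ z → + 1 + z - + 1 ≡ z
      ring = solve-∀

  infix 8 _⁻¹

  -- Junk value 0 on multiples of p.
  _⁻¹ : ℤ → ℤ
  a ⁻¹ with + p ∣? a
  ... | yes _    = + 0
  ... | no ¬p∣a = proj₁ (∃-inverse a ¬p∣a)

  *-inverseʳ : ∀ {a} → ¬ + p ∣ a → a * a ⁻¹ ≈ + 1
  *-inverseʳ {a} ¬p∣a with + p ∣? a
  ... | yes p∣a = ⊥-elim (¬p∣a p∣a)
  ... | no ¬p∣a = proj₂ (∃-inverse a ¬p∣a)

  ⁻¹-of-p∣ : ∀ {a} → + p ∣ a → a ⁻¹ ≡ + 0
  ⁻¹-of-p∣ {a} p∣a with + p ∣? a
  ... | yes _    = refl
  ... | no ¬p∣a = ⊥-elim (¬p∣a p∣a)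

  ¬p∣⁻¹ : ∀ {a} → ¬ + p ∣ a → ¬ + p ∣ a ⁻¹
  ¬p∣⁻¹ {a} ¬p∣a p∣a⁻¹ = ¬p∣1 (∣-resp-≈ (*-inverseʳ ¬p∣a) (∣n⇒∣m*n a p∣a⁻¹))

  ⁻¹-cong : ∀ {a b} → a ≈ b → a ⁻¹ ≈ b ⁻¹
  ⁻¹-cong {a} {b} a≈b = cases (+ p ∣? a)
    where
    cases : Dec (+ p ∣ a) → a ⁻¹ ≈ b ⁻¹
    cases (yes p∣a) = ≈-reflexive (trans (⁻¹-of-p∣ p∣a) (sym (⁻¹-of-p∣ (∣-resp-≈ a≈b p∣a))))
    cases (no ¬p∣a) = *-cancelˡ-≈ ¬p∣a (begin
      a * a ⁻¹ ≈⟨ *-inverseʳ ¬p∣a ⟩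
      + 1      ≈⟨ *-inverseʳ (¬p∣a ∘ ∣-resp-≈ (≈-sym a≈b)) ⟨
      b * b ⁻¹ ≈⟨ *-congʳ (b ⁻¹) a≈b ⟨
      a * b ⁻¹ ∎)
      where open ≈-Reasoning ≈-setoid

  ⁻¹-involutive : ∀ a → a ⁻¹ ⁻¹ ≈ a
  ⁻¹-involutive a = cases (+ p ∣? a)
    where
    cases : Dec (+ p ∣ a) → a ⁻¹ ⁻¹ ≈ a
    cases (yes p∣a) = ≈-trans (≈-reflexive (⁻¹-of-p∣ p∣a⁻¹)) (≈-sym (∣⇒≈0 p∣a))
      where
      p∣a⁻¹ : + p ∣ a ⁻¹
      p∣a⁻¹ = subst (+ p ∣_) (sym (⁻¹-of-p∣ p∣a)) (≈0⇒∣ ≈-refl)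
    cases (no ¬p∣a) = *-cancelˡ-≈ (¬p∣⁻¹ ¬p∣a) (begin
      a ⁻¹ * a ⁻¹ ⁻¹ ≈⟨ *-inverseʳ (¬p∣⁻¹ ¬p∣a) ⟩
      + 1            ≈⟨ *-inverseʳ ¬p∣a ⟨
      a * a ⁻¹       ≈⟨ ≈-reflexive (ℤP.*-comm a (a ⁻¹)) ⟩
      a ⁻¹ * a       ∎)
      where open ≈-Reasoning ≈-setoid

  IsSquare : ℤ → Set
  IsSquare a = ∃ λ y → y * y ≈ a

  IsSquare-resp-≈ : ∀ {a b} → a ≈ b → IsSquare a → IsSquare b
  IsSquare-resp-≈ a≈b (y , yy≈a) = y , ≈-trans yy≈a a≈b

  IsSquareMod⇔IsSquare : ∀ a → IsSquareMod p (residue a) ⇔ IsSquare a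
  IsSquareMod⇔IsSquare a = mk⇔ from-residue to-residue
    where
    +ℕ² : ∀ y → + (y ℕ.* y) ≈ + y * + y
    +ℕ² y = ≈-reflexive (ℤP.pos-* y y)
    from-residue : IsSquareMod p (residue a) → IsSquare a
    from-residue sq with Any.satisfied sq
    ... | y , yy%p≡a%p = + y , (begin
      + y * + y                ≈⟨ +ℕ² y ⟨
      + (y ℕ.* y)              ≈⟨ residue-≈ (+ (y ℕ.* y)) ⟨
      + ((y ℕ.* y) % p)        ≡⟨ cong (+_) yy%p≡a%p ⟩
      + (residue a % p)        ≈⟨ residue-≈ (+ residue a) ⟩
      + residue a              ≈⟨ residue-≈ a ⟩
      a                        ∎)
      where open ≈-Reasoning ≈-setoid
    to-residue : IsSquare a → IsSquareMod p (residue a)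
    to-residue (y , yy≈a) = AnyP.applyUpTo⁺ id (residue-cong ry²≈a) (residue<m y)
      where
      ry²≈a : + (residue y ℕ.* residue y) ≈ + residue a
      ry²≈a = ≈-trans (+ℕ² (residue y)) (≈-trans (*-cong (residue-≈ y) (residue-≈ y)) (≈-trans yy≈a (≈-sym (residue-≈ a))))

  IsSquare? : ∀ a → Dec (IsSquare a)
  IsSquare? a = Dec.map (IsSquareMod⇔IsSquare a) (isSquareMod? p (residue a))

  χ : ℤ → ℤ
  χ a = legendre a p

  χ-p∣ : ∀ {a} → + p ∣ a → χ a ≡ + 0
  χ-p∣ {a} p∣a with divℤ? p a
  ... | yes _    = refl
  ... | no ¬p∣a = ⊥-elim (¬p∣a (∣⇒∣ᵤ p∣a))

  χ-square : ∀ {a} → ¬ + p ∣ a → IsSquare a → χ a ≡ + 1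
  χ-square {a} ¬p∣a sq with divℤ? p a
  ... | yes p∣a = ⊥-elim (¬p∣a (∣ᵤ⇒∣ p∣a))
  ... | no _ with isSquareMod? p (a %ℕ p)
  ...   | yes _  = refl
  ...   | no ¬sq = ⊥-elim (¬sq (Equivalence.from (IsSquareMod⇔IsSquare a) sq))

  χ-nonsquare : ∀ {a} → ¬ + p ∣ a → ¬ IsSquare a → χ a ≡ - + 1
  χ-nonsquare {a} ¬p∣a ¬sq with divℤ? p a
  ... | yes p∣a = ⊥-elim (¬p∣a (∣ᵤ⇒∣ p∣a))
  ... | no _ with isSquareMod? p (a %ℕ p)
  ...   | yes sq = ⊥-elim (¬sq (Equivalence.to (IsSquareMod⇔IsSquare a) sq))
  ...   | no _   = refl

  data Residuosity (a : ℤ) : Set where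
    divisible : + p ∣ a → Residuosity a
    square    : ¬ + p ∣ a → IsSquare a → Residuosity a
    nonsquare : ¬ + p ∣ a → ¬ IsSquare a → Residuosity a

  residuosity : ∀ a → Residuosity a
  residuosity a with + p ∣? a | IsSquare? a
  ... | yes p∣a  | _       = divisible p∣a
  ... | no ¬p∣a | yes sq  = square ¬p∣a sq
  ... | no ¬p∣a | no ¬sq = nonsquare ¬p∣a ¬sq

  χ-cong : χ Preserves _≈_ ⟶ _≡_
  χ-cong {a} {b} a≈b with residuosity a
  ... | divisible p∣a    = trans (χ-p∣ p∣a) (sym (χ-p∣ (∣-resp-≈ a≈b p∣a)))
  ... | square ¬p∣a sq   = trans (χ-square ¬p∣a sq)
    (sym (χ-square (¬p∣a ∘ ∣-resp-≈ (≈-sym a≈b)) (IsSquare-resp-≈ a≈b sq)))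
  ... | nonsquare ¬p∣a ¬sq = trans (χ-nonsquare ¬p∣a ¬sq)
    (sym (χ-nonsquare (¬p∣a ∘ ∣-resp-≈ (≈-sym a≈b)) (¬sq ∘ IsSquare-resp-≈ (≈-sym a≈b))))

  χ≤1 : ∀ a → χ a ≤ + 1
  χ≤1 a with residuosity a
  ... | divisible p∣a      = subst (_≤ + 1) (sym (χ-p∣ p∣a)) (ℤ.+≤+ ℕ.z≤n)
  ... | square ¬p∣a sq     = subst (_≤ + 1) (sym (χ-square ¬p∣a sq)) ℤP.≤-refl
  ... | nonsquare ¬p∣a ¬sq = subst (_≤ + 1) (sym (χ-nonsquare ¬p∣a ¬sq)) ℤ.-≤+

  χ-1 : χ (+ 1) ≡ + 1
  χ-1 = χ-square ¬p∣1 (+ 1 , ≈-refl)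

  IsSquare-* : ∀ {a b} → IsSquare a → IsSquare b → IsSquare (a * b)
  IsSquare-* {a} {b} (y , yy≈a) (z , zz≈b) = y * z , ≈-trans (≈-reflexive (ring y z)) (*-cong yy≈a zz≈b)
    where
    ring : ∀ y z → (y * z) * (y * z) ≡ (y * y) * (z * z)
    ring = solve-∀

  IsSquare-cancelˡ : ∀ {a b} → ¬ + p ∣ a → IsSquare a → IsSquare (a * b) → IsSquare b
  IsSquare-cancelˡ {a} {b} ¬p∣a (y , yy≈a) (w , ww≈ab) = w * y ⁻¹ , (begin
    (w * y ⁻¹) * (w * y ⁻¹)         ≡⟨ ring w (y ⁻¹) ⟩
    (w * w) * (y ⁻¹ * y ⁻¹)         ≈⟨ *-congʳ (y ⁻¹ * y ⁻¹) ww≈ab ⟩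
    (a * b) * (y ⁻¹ * y ⁻¹)         ≈⟨ *-congʳ (y ⁻¹ * y ⁻¹) (*-congʳ b (≈-sym yy≈a)) ⟩
    (y * y) * b * (y ⁻¹ * y ⁻¹)     ≡⟨ ring′ y b (y ⁻¹) ⟩
    b * ((y * y ⁻¹) * (y * y ⁻¹))   ≈⟨ *-congˡ b (*-cong (*-inverseʳ ¬p∣y) (*-inverseʳ ¬p∣y)) ⟩
    b * (+ 1 * + 1)                 ≡⟨ ℤP.*-identityʳ b ⟩
    b                               ∎)
    where
    open ≈-Reasoning ≈-setoid
    ¬p∣y : ¬ + p ∣ y
    ¬p∣y p∣y = ¬p∣a (∣-resp-≈ yy≈a (∣n⇒∣m*n y p∣y))
    ring : ∀ w y′ → (w * y′) * (w * y′) ≡ (w * w) * (y′ * y′)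
    ring = solve-∀
    ring′ : ∀ y b y′ → (y * y) * b * (y′ * y′) ≡ b * ((y * y′) * (y * y′))
    ring′ = solve-∀

  χ-*-square : ∀ {a} → ¬ + p ∣ a → IsSquare a → ∀ b → χ (a * b) ≡ χ b
  χ-*-square {a} ¬p∣a sq-a b with residuosity b
  ... | divisible p∣b      = trans (χ-p∣ (∣n⇒∣m*n a p∣b)) (sym (χ-p∣ p∣b))
  ... | square ¬p∣b sq-b   = trans (χ-square (¬p∣* ¬p∣a ¬p∣b) (IsSquare-* sq-a sq-b)) (sym (χ-square ¬p∣b sq-b))
  ... | nonsquare ¬p∣b ¬sq-b = trans (χ-nonsquare (¬p∣* ¬p∣a ¬p∣b) (¬sq-b ∘ IsSquare-cancelˡ ¬p∣a sq-a))
                                     (sym (χ-nonsquare ¬p∣b ¬sq-b))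

  χ-cube : ∀ x → χ (x * x * x) ≡ χ x
  χ-cube x with + p ∣? x
  ... | yes p∣x  = trans (χ-p∣ (∣n⇒∣m*n (x * x) p∣x)) (sym (χ-p∣ p∣x))
  ... | no ¬p∣x = χ-*-square (¬p∣* ¬p∣x ¬p∣x) (x , ≈-refl) x

  χ-⁻¹ : ∀ a → χ (a ⁻¹) ≡ χ a
  χ-⁻¹ a = cases (+ p ∣? a)
    where
    cases : Dec (+ p ∣ a) → χ (a ⁻¹) ≡ χ a
    cases (yes p∣a) = trans (cong χ (⁻¹-of-p∣ p∣a)) (trans (χ-p∣ (≈0⇒∣ ≈-refl)) (sym (χ-p∣ p∣a)))
    cases (no ¬p∣a) = trans (χ-cong a⁻¹≈a⁻¹²a) (χ-*-square (¬p∣* ¬p∣a⁻¹ ¬p∣a⁻¹) (a ⁻¹ , ≈-refl) a)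
      where
      ¬p∣a⁻¹ = ¬p∣⁻¹ ¬p∣a
      a⁻¹≈a⁻¹²a : a ⁻¹ ≈ a ⁻¹ * a ⁻¹ * a
      a⁻¹≈a⁻¹²a = begin
        a ⁻¹                 ≡⟨ ℤP.*-identityʳ (a ⁻¹) ⟨
        a ⁻¹ * + 1           ≈⟨ *-congˡ (a ⁻¹) (*-inverseʳ ¬p∣a) ⟨
        a ⁻¹ * (a * a ⁻¹)    ≡⟨ ring (a ⁻¹) a ⟩
        a ⁻¹ * a ⁻¹ * a      ∎
        where
        open ≈-Reasoning ≈-setoid
        ring : ∀ b a → b * (a * b) ≡ b * b * a
        ring = solve-∀

  ∑-affine : ∀ {F : ℤ → ℤ} c d → ¬ + p ∣ c → F Preserves _≈_ ⟶ _≡_ → ∑ (λ x → F (c * x + d)) ≡ ∑ F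
  ∑-affine {F} c d ¬p∣c F-cong = ∑-reindex {F} {λ x → c * x + d} (λ y → c ⁻¹ * (y - d)) F-cong
    (+-congʳ d ∘ *-congˡ c) affine∘inverse (*-cancelˡ-≈ ¬p∣c ∘ cancel-d)
    where
    affine∘inverse : ∀ y → c * (c ⁻¹ * (y - d)) + d ≈ y
    affine∘inverse y = begin
      c * (c ⁻¹ * (y - d)) + d ≡⟨ ring c (c ⁻¹) y d ⟩
      c * c ⁻¹ * (y - d) + d   ≈⟨ +-congʳ d (*-congʳ (y - d) (*-inverseʳ ¬p∣c)) ⟩
      + 1 * (y - d) + d        ≡⟨ ring′ y d ⟩
      y                        ∎
      where
      open ≈-Reasoning ≈-setoid
      ring : ∀ c c′ y d → c * (c′ * (y - d)) + d ≡ c * c′ * (y - d) + d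
      ring = solve-∀
      ring′ : ∀ y d → + 1 * (y - d) + d ≡ y
      ring′ = solve-∀
    cancel-d : ∀ {x y} → c * x + d ≈ c * y + d → c * x ≈ c * y
    cancel-d {x} {y} e = ≈-trans (≈-reflexive (ring (c * x) d)) (≈-trans (+-congʳ (- d) e) (≈-reflexive (sym (ring (c * y) d))))
      where
      ring : ∀ z d → z ≡ z + d - d
      ring = solve-∀

module OddPrime (p : ℕ) .{{_ : NonZero p}} (p-prime : Prime p) (2<p : 2 ℕ.< p) where

  open PrimeField p p-prime public

  ¬p∣2 : ¬ + p ∣ + 2
  ¬p∣2 = ¬p∣0<n<p (ℕ.s≤s ℕ.z≤n) 2<p

  ≉-neg : ∀ {a} → ¬ + p ∣ a → ¬ a ≈ - a
  ≉-neg {a} ¬p∣a (mk≈ p∣a+a) = ¬p∣* ¬p∣2 ¬p∣a (subst (+ p ∣_) (ring a) p∣a+a)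
    where
    ring : ∀ a → a - - a ≡ + 2 * a
    ring = solve-∀

  squares-≈⇒≈± : ∀ {y z} → y * y ≈ z * z → y ≈ z ⊎ y ≈ - z
  squares-≈⇒≈± {y} {z} (mk≈ p∣y²-z²) =
    Sum.map mk≈ (mk≈ ∘ subst (+ p ∣_) (ring₂ y z)) (p∣*⇒p∣⊎p∣ (y - z) (y + z) (subst (+ p ∣_) (ring₁ y z) p∣y²-z²))
    where
    ring₁ : ∀ y z → y * y - z * z ≡ (y - z) * (y + z)
    ring₁ = solve-∀
    ring₂ : ∀ y z → y + z ≡ y - - z
    ring₂ = solve-∀

  𝟙-square-roots : ∀ {z} → ¬ + p ∣ z → ∀ y → 𝟙 (y * y ≈? z * z) ≡ 𝟙 (y ≈? z) + 𝟙 (y ≈? - z)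
  𝟙-square-roots {z} ¬p∣z y = 𝟙-disjoint-⊎ (y ≈? z) (y ≈? - z) (y * y ≈? z * z)
    (mk⇔ squares-≈⇒≈± [ (λ y≈z → *-cong y≈z y≈z) , (λ y≈-z → ≈-trans (*-cong y≈-z y≈-z) (≈-reflexive (ring z))) ])
    (λ y≈z y≈-z → ≉-neg ¬p∣z (≈-trans (≈-sym y≈z) y≈-z))
    where
    ring : ∀ z → - z * - z ≡ z * z
    ring = solve-∀

  #roots : ℤ → ℤ
  #roots a = ∑ λ y → 𝟙 (y * y ≈? a)

  #roots≡1+χ : ∀ a → #roots a ≡ + 1 + χ a
  #roots≡1+χ a with residuosity a
  ... | divisible p∣a = begin
    ∑ (λ y → 𝟙 (y * y ≈? a)) ≡⟨ ∑-cong (λ y → 𝟙-cong (y * y ≈? a) (y ≈? + 0) (mk⇔ root⇒≈0 ≈0⇒root)) ⟩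
    ∑ (λ y → 𝟙 (y ≈? + 0))   ≡⟨ ∑-count (+ 0) ⟩
    + 1                      ≡⟨ cong (_+_ (+ 1)) (χ-p∣ p∣a) ⟨
    + 1 + χ a                ∎
    where
    open ≡-Reasoning
    root⇒≈0 : ∀ {y} → y * y ≈ a → y ≈ + 0
    root⇒≈0 yy≈a = ∣⇒≈0 (p∣square⇒p∣ (∣-resp-≈ (≈-sym yy≈a) p∣a))
    ≈0⇒root : ∀ {y} → y ≈ + 0 → y * y ≈ a
    ≈0⇒root y≈0 = ≈-trans (*-cong y≈0 y≈0) (≈-sym (∣⇒≈0 p∣a))
  ... | square ¬p∣a (z , zz≈a) = begin
    ∑ (λ y → 𝟙 (y * y ≈? a))                ≡⟨ ∑-cong (λ y → 𝟙-≈?-cong (≈-refl {y * y}) (≈-sym zz≈a)) ⟩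
    ∑ (λ y → 𝟙 (y * y ≈? z * z))            ≡⟨ ∑-cong (𝟙-square-roots ¬p∣z) ⟩
    ∑ (λ y → 𝟙 (y ≈? z) + 𝟙 (y ≈? - z))     ≡⟨ ∑-+ _ _ ⟩
    ∑ (λ y → 𝟙 (y ≈? z)) + ∑ (λ y → 𝟙 (y ≈? - z)) ≡⟨ cong₂ _+_ (∑-count z) (∑-count (- z)) ⟩
    + 1 + + 1                               ≡⟨ cong (_+_ (+ 1)) (χ-square ¬p∣a (z , zz≈a)) ⟨
    + 1 + χ a                               ∎
    where
    open ≡-Reasoning
    ¬p∣z : ¬ + p ∣ z
    ¬p∣z p∣z = ¬p∣a (∣-resp-≈ zz≈a (∣n⇒∣m*n z p∣z))
  ... | nonsquare ¬p∣a ¬sq = begin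
    ∑ (λ y → 𝟙 (y * y ≈? a))  ≡⟨ ∑-cong (λ y → 𝟙-no (y * y ≈? a) (λ yy≈a → ¬sq (y , yy≈a))) ⟩
    ∑ (λ _ → + 0)             ≡⟨ trans (∑-const (+ 0)) (ℤP.*-zeroʳ (+ p)) ⟩
    + 0                       ≡⟨ cong (_+_ (+ 1)) (χ-nonsquare ¬p∣a ¬sq) ⟨
    + 1 + χ a                 ∎
    where open ≡-Reasoning

  ∑-#roots : ∑ #roots ≡ + p
  ∑-#roots = begin
    ∑ (λ a → ∑ (λ y → 𝟙 (y * y ≈? a))) ≡⟨ ∑-comm _ ⟩
    ∑ (λ y → ∑ (λ a → 𝟙 (y * y ≈? a))) ≡⟨ ∑-cong (λ y → trans (∑-cong (λ a → 𝟙-sym (y * y) a)) (∑-count (y * y))) ⟩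
    ∑ (λ _ → + 1)                      ≡⟨ ∑-const (+ 1) ⟩
    + p * + 1                          ≡⟨ ℤP.*-identityʳ (+ p) ⟩
    + p                                ∎
    where open ≡-Reasoning

  ∑χ≡0 : ∑ χ ≡ + 0
  ∑χ≡0 = begin
    ∑ χ                          ≡⟨ ring (+ p) (∑ χ) ⟩
    (+ p * + 1 + ∑ χ) - + p      ≡⟨ cong (λ s → s + ∑ χ - + p) (∑-const (+ 1)) ⟨
    (∑ (λ _ → + 1) + ∑ χ) - + p  ≡⟨ cong (_- + p) (∑-+ (λ _ → + 1) χ) ⟨
    ∑ (λ a → + 1 + χ a) - + p    ≡⟨ cong (_- + p) (trans (∑-cong (sym ∘ #roots≡1+χ)) ∑-#roots) ⟩
    + p - + p                    ≡⟨ ℤP.+-inverseʳ (+ p) ⟩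
    + 0                          ∎
    where
    open ≡-Reasoning
    ring : ∀ p s → s ≡ (p * + 1 + s) - p
    ring = solve-∀

  -- Each term χ(ax) + χ(x) is ≤ 0, and the terms sum to Σ χ + Σ χ = 0, so they all vanish.
  χ-*-nonsquare : ∀ {a} → ¬ + p ∣ a → ¬ IsSquare a → ∀ b → χ (a * b) ≡ - χ b
  χ-*-nonsquare {a} ¬p∣a ¬sq-a b = begin
    χ (a * b)          ≡⟨ ring (χ (a * b)) (χ b) ⟩
    F b - χ b          ≡⟨ cong (_- χ b) (∑-nonpositive-≡0 F-cong F≤0 ∑F≡0 b) ⟩
    + 0 - χ b          ≡⟨ ℤP.+-identityˡ (- χ b) ⟩
    - χ b              ∎
    where
    F : ℤ → ℤ
    F x = χ (a * x) + χ x
    F-cong : F Preserves _≈_ ⟶ _≡_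
    F-cong x≈y = cong₂ _+_ (χ-cong (*-congˡ a x≈y)) (χ-cong x≈y)
    F≤0 : ∀ x → F x ≤ + 0
    F≤0 x with residuosity x
    ... | divisible p∣x = ℤP.≤-reflexive (cong₂ _+_ (χ-p∣ (∣n⇒∣m*n a p∣x)) (χ-p∣ p∣x))
    ... | square ¬p∣x sq-x = ℤP.≤-reflexive (cong₂ _+_ (χ-nonsquare (¬p∣* ¬p∣a ¬p∣x) ¬sq-ax) (χ-square ¬p∣x sq-x))
      where
      ¬sq-ax : ¬ IsSquare (a * x)
      ¬sq-ax sq-ax = ¬sq-a (IsSquare-cancelˡ ¬p∣x sq-x (IsSquare-resp-≈ (≈-reflexive (ℤP.*-comm a x)) sq-ax))
    ... | nonsquare ¬p∣x ¬sq-x = subst (λ c → χ (a * x) + c ≤ + 0) (sym (χ-nonsquare ¬p∣x ¬sq-x))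
                                   (ℤP.+-monoˡ-≤ (- + 1) (χ≤1 (a * x)))
    open ≡-Reasoning
    ∑F≡0 : ∑ F ≡ + 0
    ∑F≡0 = begin
      ∑ F                               ≡⟨ ∑-+ _ χ ⟩
      ∑ (λ x → χ (a * x)) + ∑ χ         ≡⟨ cong (_+ ∑ χ) (∑-cong (λ x → cong χ (ℤP.+-identityʳ (a * x)))) ⟨
      ∑ (λ x → χ (a * x + + 0)) + ∑ χ   ≡⟨ cong₂ _+_ (∑-affine a (+ 0) ¬p∣a χ-cong) ∑χ≡0 ⟩
      ∑ χ + + 0                         ≡⟨ ℤP.+-identityʳ (∑ χ) ⟩
      ∑ χ                               ≡⟨ ∑χ≡0 ⟩
      + 0                               ∎
    ring : ∀ u v → u ≡ (u + v) - v
    ring = solve-∀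

  χ-* : ∀ a b → χ (a * b) ≡ χ a * χ b
  χ-* a b with residuosity a
  ... | divisible p∣a      = trans (χ-p∣ (∣m⇒∣m*n b p∣a)) (sym (cong (_* χ b) (χ-p∣ p∣a)))
  ... | square ¬p∣a sq     = trans (χ-*-square ¬p∣a sq b)
    (sym (trans (cong (_* χ b) (χ-square ¬p∣a sq)) (ℤP.*-identityˡ (χ b))))
  ... | nonsquare ¬p∣a ¬sq = trans (χ-*-nonsquare ¬p∣a ¬sq b)
    (sym (trans (cong (_* χ b) (χ-nonsquare ¬p∣a ¬sq)) (ℤP.-1*i≡-i (χ b))))

  ∑χ-affine : ∀ c d → ¬ + p ∣ c → ∑ (λ x → χ (c * x + d)) ≡ + 0
  ∑χ-affine c d ¬p∣c = trans (∑-affine c d ¬p∣c χ-cong) ∑χ≡0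

  ∑χ[1-d*] : ∀ d → ∑ (λ u → χ (+ 1 - d * u)) ≡ + p * 𝟙 (d ≈? + 0)
  ∑χ[1-d*] d with d ≈? + 0
  ... | yes d≈0 = trans (∑-cong (λ u → trans (χ-cong (1-du≈1 u)) χ-1)) (∑-const (+ 1))
    where
    1-du≈1 : ∀ u → + 1 - d * u ≈ + 1
    1-du≈1 u = ≈-trans (+-congˡ (+ 1) (-‿cong (*-congʳ u d≈0))) (≈-reflexive (ring u))
      where
      ring : ∀ u → + 1 - + 0 * u ≡ + 1
      ring = solve-∀
  ... | no d≉0 = begin
    ∑ (λ u → χ (+ 1 - d * u))     ≡⟨ ∑-cong (λ u → cong χ (ring d u)) ⟩
    ∑ (λ u → χ (- d * u + + 1))   ≡⟨ ∑χ-affine (- d) (+ 1) (¬p∣- (d≉0 ∘ ∣⇒≈0)) ⟩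
    + 0                           ≡⟨ ℤP.*-zeroʳ (+ p) ⟨
    + p * + 0                     ∎
    where
    open ≡-Reasoning
    ring : ∀ d u → + 1 - d * u ≡ - d * u + + 1
    ring = solve-∀

  v*[v-d]≈v²*[1-d*v⁻¹] : ∀ d {v} → ¬ + p ∣ v → v * (v - d) ≈ v * v * (+ 1 - d * v ⁻¹)
  v*[v-d]≈v²*[1-d*v⁻¹] d {v} ¬p∣v = begin
    v * (v - d)                        ≡⟨ ring₁ v d ⟩
    v * v - d * v * + 1                ≈⟨ +-congˡ (v * v) (-‿cong (*-congˡ (d * v) (*-inverseʳ ¬p∣v))) ⟨
    v * v - d * v * (v * v ⁻¹)         ≡⟨ ring₂ v d (v ⁻¹) ⟩
    v * v * (+ 1 - d * v ⁻¹)           ∎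
    where
    open ≈-Reasoning ≈-setoid
    ring₁ : ∀ v d → v * (v - d) ≡ v * v - d * v * + 1
    ring₁ = solve-∀
    ring₂ : ∀ v d v′ → v * v - d * v * (v * v′) ≡ v * v * (+ 1 - d * v′)
    ring₂ = solve-∀

  χ[v*[v-d]] : ∀ d v → χ (v * (v - d)) ≡ χ (+ 1 - d * v ⁻¹) - 𝟙 (v ≈? + 0)
  χ[v*[v-d]] d v with v ≈? + 0
  ... | yes v≈0 = begin
    χ (v * (v - d))           ≡⟨ χ-p∣ (∣m⇒∣m*n (v - d) (≈0⇒∣ v≈0)) ⟩
    + 0                       ≡⟨ ℤP.+-inverseʳ (+ 1) ⟨
    + 1 - + 1                 ≡⟨ cong (_- + 1) (trans (cong χ (ring d)) χ-1) ⟨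
    χ (+ 1 - d * + 0) - + 1   ≡⟨ cong (λ u → χ (+ 1 - d * u) - + 1) (⁻¹-of-p∣ (≈0⇒∣ v≈0)) ⟨
    χ (+ 1 - d * v ⁻¹) - + 1  ∎
    where
    open ≡-Reasoning
    ring : ∀ d → + 1 - d * + 0 ≡ + 1
    ring = solve-∀
  ... | no v≉0 = begin
    χ (v * (v - d))                    ≡⟨ χ-cong (v*[v-d]≈v²*[1-d*v⁻¹] d ¬p∣v) ⟩
    χ (v * v * (+ 1 - d * v ⁻¹))       ≡⟨ χ-*-square (¬p∣* ¬p∣v ¬p∣v) (v , ≈-refl) _ ⟩
    χ (+ 1 - d * v ⁻¹)                 ≡⟨ ℤP.+-identityʳ _ ⟨
    χ (+ 1 - d * v ⁻¹) - + 0           ∎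
    where
    open ≡-Reasoning
    ¬p∣v : ¬ + p ∣ v
    ¬p∣v = v≉0 ∘ ∣⇒≈0

  -- Σₓ χ(x² − d) = Σᵥ #roots(v) χ(v − d) = Σᵥ χ(v − d) + Σᵥ χ(v(v − d)), and χ(v(v − d)) = χ(1 − d v⁻¹) for v ≢ 0.
  ∑χ[x²-d] : ∀ d → ∑ (λ x → χ (x * x - d)) ≡ + p * 𝟙 (d ≈? + 0) - + 1
  ∑χ[x²-d] d = begin
    ∑ (λ x → χ (x * x - d))
      ≡⟨ ∑-cong (λ x → ∑-δ (x * x) (χ-cong ∘ +-congʳ (- d))) ⟨
    ∑ (λ x → ∑ (λ v → 𝟙 (v ≈? x * x) * χ (v - d)))
      ≡⟨ ∑-comm _ ⟩
    ∑ (λ v → ∑ (λ x → 𝟙 (v ≈? x * x) * χ (v - d)))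
      ≡⟨ ∑-cong (λ v → *-distribʳ-∑ (χ (v - d)) _) ⟨
    ∑ (λ v → ∑ (λ x → 𝟙 (v ≈? x * x)) * χ (v - d))
      ≡⟨ ∑-cong (λ v → cong (_* χ (v - d)) (trans (∑-cong (λ x → 𝟙-sym v (x * x))) (#roots≡1+χ v))) ⟩
    ∑ (λ v → (+ 1 + χ v) * χ (v - d))
      ≡⟨ ∑-cong (λ v → ℤP.*-distribʳ-+ (χ (v - d)) (+ 1) (χ v)) ⟩
    ∑ (λ v → + 1 * χ (v - d) + χ v * χ (v - d))
      ≡⟨ ∑-+ _ _ ⟩
    ∑ (λ v → + 1 * χ (v - d)) + ∑ (λ v → χ v * χ (v - d))
      ≡⟨ cong₂ _+_ ∑χ[v-d]≡0 (∑-cong (λ v → trans (sym (χ-* v (v - d))) (χ[v*[v-d]] d v))) ⟩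
    + 0 + ∑ (λ v → χ (+ 1 - d * v ⁻¹) - 𝟙 (v ≈? + 0))
      ≡⟨ trans (ℤP.+-identityˡ _) (∑-+ _ _) ⟩
    ∑ (λ v → χ (+ 1 - d * v ⁻¹)) + ∑ (λ v → - 𝟙 (v ≈? + 0))
      ≡⟨ cong₂ _+_ (∑-involution (χ-cong ∘ +-congˡ (+ 1) ∘ -‿cong ∘ *-congˡ d) ⁻¹-cong ⁻¹-involutive)
                   (trans (sym (neg-distrib-∑ _)) (cong -_ (∑-count (+ 0)))) ⟩
    ∑ (λ u → χ (+ 1 - d * u)) - + 1
      ≡⟨ cong (_- + 1) (∑χ[1-d*] d) ⟩
    + p * 𝟙 (d ≈? + 0) - + 1 ∎
    where
    open ≡-Reasoning
    ∑χ[v-d]≡0 : ∑ (λ v → + 1 * χ (v - d)) ≡ + 0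
    ∑χ[v-d]≡0 = trans (∑-cong (λ v → trans (ℤP.*-identityˡ _) (cong χ (cong (_+ - d) (sym (ℤP.*-identityˡ v))))))
                      (∑χ-affine (+ 1) (- d) ¬p∣1)

  qr : ℤ → ℤ
  qr a = 𝟙 (χ a ℤ.≟ + 1)

  qr-value : ∀ {a c} → χ a ≡ c → qr a ≡ 𝟙 (c ℤ.≟ + 1)
  qr-value = cong (λ c → 𝟙 (c ℤ.≟ + 1))

  qr-cong : qr Preserves _≈_ ⟶ _≡_
  qr-cong = qr-value ∘ χ-cong

  2*qr : ∀ a → + 2 * qr a ≡ χ a + (+ 1 - 𝟙 (a ≈? + 0))
  2*qr a with residuosity a
  ... | divisible p∣a
    rewrite χ-p∣ p∣a | 𝟙-yes (a ≈? + 0) (∣⇒≈0 p∣a) = refl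
  ... | square ¬p∣a sq
    rewrite χ-square ¬p∣a sq | 𝟙-no (a ≈? + 0) (¬p∣a ∘ ≈0⇒∣) = refl
  ... | nonsquare ¬p∣a ¬sq
    rewrite χ-nonsquare ¬p∣a ¬sq | 𝟙-no (a ≈? + 0) (¬p∣a ∘ ≈0⇒∣) = refl

  2*∑qr : + 2 * ∑ qr ≡ + p - + 1
  2*∑qr = begin
    + 2 * ∑ qr                                               ≡⟨ *-distribˡ-∑ (+ 2) qr ⟩
    ∑ (λ a → + 2 * qr a)                                     ≡⟨ ∑-cong 2*qr ⟩
    ∑ (λ a → χ a + (+ 1 - 𝟙 (a ≈? + 0)))                     ≡⟨ ∑-+ χ _ ⟩
    ∑ χ + ∑ (λ a → + 1 - 𝟙 (a ≈? + 0))                       ≡⟨ cong₂ _+_ ∑χ≡0 (∑-+ _ _) ⟩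
    + 0 + (∑ (λ _ → + 1) + ∑ (λ a → - 𝟙 (a ≈? + 0)))         ≡⟨ ℤP.+-identityˡ _ ⟩
    ∑ (λ _ → + 1) + ∑ (λ a → - 𝟙 (a ≈? + 0))                 ≡⟨ cong₂ _+_ (∑-const (+ 1)) (sym (neg-distrib-∑ _)) ⟩
    + p * + 1 - ∑ (λ a → 𝟙 (a ≈? + 0))                       ≡⟨ cong₂ _-_ (ℤP.*-identityʳ (+ p)) (∑-count (+ 0)) ⟩
    + p - + 1                                                ∎
    where open ≡-Reasoning

  ⁻¹-fixed-points : ∀ a → 𝟙 (a ⁻¹ ≈? a) * qr a ≡ (𝟙 (a ≈? + 1) + 𝟙 (a ≈? - + 1)) * qr a
  ⁻¹-fixed-points a = cases (+ p ∣? a)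
    where
    cases : Dec (+ p ∣ a) → 𝟙 (a ⁻¹ ≈? a) * qr a ≡ (𝟙 (a ≈? + 1) + 𝟙 (a ≈? - + 1)) * qr a
    cases (yes p∣a) = trans (*qr≡0 (𝟙 (a ⁻¹ ≈? a))) (sym (*qr≡0 (𝟙 (a ≈? + 1) + 𝟙 (a ≈? - + 1))))
      where
      *qr≡0 : ∀ c → c * qr a ≡ + 0
      *qr≡0 c = trans (cong (c *_) (qr-value (χ-p∣ p∣a))) (ℤP.*-zeroʳ c)
    cases (no ¬p∣a) = cong (_* qr a) (𝟙-disjoint-⊎ (a ≈? + 1) (a ≈? - + 1) (a ⁻¹ ≈? a)
      (mk⇔ (λ a⁻¹≈a → squares-≈⇒≈± (≈-trans (*-congˡ a (≈-sym a⁻¹≈a)) (*-inverseʳ ¬p∣a)))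
           [ ≈±1⇒a⁻¹≈a ∘ (λ a≈1 → *-cong a≈1 a≈1) , ≈±1⇒a⁻¹≈a ∘ (λ a≈-1 → *-cong a≈-1 a≈-1) ])
      (λ a≈1 a≈-1 → ≉-neg ¬p∣1 (≈-trans (≈-sym a≈1) a≈-1)))
      where
      ≈±1⇒a⁻¹≈a : a * a ≈ + 1 → a ⁻¹ ≈ a
      ≈±1⇒a⁻¹≈a aa≈1 = *-cancelˡ-≈ ¬p∣a (≈-trans (*-inverseʳ ¬p∣a) (≈-sym aa≈1))

  ∑-⁻¹-fixed-points : ∑ (λ a → 𝟙 (a ⁻¹ ≈? a) * qr a) ≡ qr (+ 1) + qr (- + 1)
  ∑-⁻¹-fixed-points = begin
    ∑ (λ a → 𝟙 (a ⁻¹ ≈? a) * qr a)                            ≡⟨ ∑-cong ⁻¹-fixed-points ⟩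
    ∑ (λ a → (𝟙 (a ≈? + 1) + 𝟙 (a ≈? - + 1)) * qr a)
      ≡⟨ ∑-cong (λ a → ℤP.*-distribʳ-+ (qr a) (𝟙 (a ≈? + 1)) (𝟙 (a ≈? - + 1))) ⟩
    ∑ (λ a → 𝟙 (a ≈? + 1) * qr a + 𝟙 (a ≈? - + 1) * qr a)     ≡⟨ ∑-+ _ _ ⟩
    ∑ (λ a → 𝟙 (a ≈? + 1) * qr a) + ∑ (λ a → 𝟙 (a ≈? - + 1) * qr a)
      ≡⟨ cong₂ _+_ (∑-δ (+ 1) qr-cong) (∑-δ (- + 1) qr-cong) ⟩
    qr (+ 1) + qr (- + 1)                                     ∎
    where open ≡-Reasoning

  p≡4k+3+2qr[-1] : ∃ λ k → + p ≡ + 4 * k + + 3 + + 2 * qr (- + 1)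
  p≡4k+3+2qr[-1] = from-parity (∑-involution-parity qr-cong ⁻¹-cong ⁻¹-involutive qr∘⁻¹≗qr)
    where
    qr∘⁻¹≗qr : ∀ a → qr (a ⁻¹) ≡ qr a
    qr∘⁻¹≗qr a = qr-value (χ-⁻¹ a)
    from-parity : (∃ λ k → ∑ qr ≡ + 2 * k + ∑ (λ a → 𝟙 (a ⁻¹ ≈? a) * qr a)) →
                  ∃ λ k → + p ≡ + 4 * k + + 3 + + 2 * qr (- + 1)
    from-parity (k , ∑qr≡2k+fixed) = k , (begin
      + p                                                 ≡⟨ ring₁ (+ p) ⟩
      (+ p - + 1) + + 1                                   ≡⟨ cong (_+ + 1) 2*∑qr ⟨
      + 2 * ∑ qr + + 1
        ≡⟨ cong (λ s → + 2 * s + + 1) (trans ∑qr≡2k+fixed (cong (_+_ (+ 2 * k)) ∑-⁻¹-fixed-points)) ⟩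
      + 2 * (+ 2 * k + (qr (+ 1) + qr (- + 1))) + + 1     ≡⟨ cong (λ c → + 2 * (+ 2 * k + (c + qr (- + 1))) + + 1) qr[1]≡1 ⟩
      + 2 * (+ 2 * k + (+ 1 + qr (- + 1))) + + 1          ≡⟨ ring₂ k (qr (- + 1)) ⟩
      + 4 * k + + 3 + + 2 * qr (- + 1)                    ∎)
      where
      open ≡-Reasoning
      qr[1]≡1 : qr (+ 1) ≡ + 1
      qr[1]≡1 = qr-value χ-1
      ring₁ : ∀ p → p ≡ (p - + 1) + + 1
      ring₁ = solve-∀
      ring₂ : ∀ k q → + 2 * (+ 2 * k + (+ 1 + q)) + + 1 ≡ + 4 * k + + 3 + + 2 * q
      ring₂ = solve-∀

  IsSquare[-1]⇔p%4≡1 : IsSquare (- + 1) ⇔ p % 4 ≡ 1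
  IsSquare[-1]⇔p%4≡1 = mk⇔ square⇒≡1 (Dec.decidable-stable (IsSquare? (- + 1)) ∘ ≡1⇒¬¬square)
    where
    k = proj₁ p≡4k+3+2qr[-1]
    p≡4k+3+2qr = proj₂ p≡4k+3+2qr[-1]
    square⇒≡1 : IsSquare (- + 1) → p % 4 ≡ 1
    square⇒≡1 sq =
      Congruence.n≡m*k+r⇒n%m≡r 4 (k + + 1) (trans p≡4k+3+2qr (ring k (qr (- + 1)) qr≡1)) (ℕ.s≤s (ℕ.s≤s ℕ.z≤n))
      where
      qr≡1 : qr (- + 1) ≡ + 1
      qr≡1 = qr-value (χ-square ¬p∣-1 sq)
      ring : ∀ k q → q ≡ + 1 → + 4 * k + + 3 + + 2 * q ≡ + 4 * (k + + 1) + + 1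
      ring k q refl = lemma k
        where
        lemma : ∀ k → + 4 * k + + 3 + + 2 * + 1 ≡ + 4 * (k + + 1) + + 1
        lemma = solve-∀
    ≡1⇒¬¬square : p % 4 ≡ 1 → ¬ ¬ IsSquare (- + 1)
    ≡1⇒¬¬square p%4≡1 ¬sq = 3≢1 (trans (sym p%4≡3) p%4≡1)
      where
      qr≡0 : qr (- + 1) ≡ + 0
      qr≡0 = qr-value (χ-nonsquare ¬p∣-1 ¬sq)
      p%4≡3 : p % 4 ≡ 3
      p%4≡3 = Congruence.n≡m*k+r⇒n%m≡r 4 k
        (trans p≡4k+3+2qr (trans (cong (λ q → + 4 * k + + 3 + + 2 * q) qr≡0) (ℤP.+-identityʳ _))) ℕP.≤-refl
      3≢1 : 3 ≢ 1
      3≢1 ()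

module Family (p : ℕ) .{{_ : NonZero p}} (p-prime : Prime p) (4<p : 4 ℕ.< p) where

  open OddPrime p p-prime (ℕP.<-trans (ℕ.s≤s (ℕ.s≤s (ℕ.s≤s ℕ.z≤n))) 4<p)

  ¬p∣4 : ¬ + p ∣ + 4
  ¬p∣4 = ¬p∣* ¬p∣2 ¬p∣2

  ¬p∣36 : ¬ + p ∣ + 36
  ¬p∣36 = ¬p∣* ¬p∣4 (¬p∣* ¬p∣3 ¬p∣3)
    where
    ¬p∣3 : ¬ + p ∣ + 3
    ¬p∣3 = ¬p∣0<n<p (ℕ.s≤s ℕ.z≤n) (ℕP.<-trans (ℕP.n<1+n 3) 4<p)

  χ-4* : ∀ z → χ (+ 4 * z) ≡ χ z
  χ-4* = χ-*-square ¬p∣4 (+ 2 , ≈-refl)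

  -- a_t(p) as a function of u = 36t + 6, so that 36t + 5 = u − 1.
  aᵤ : ℤ → ℤ
  aᵤ u = - ∑ (λ x → χ (x * x * x - u * (u - + 1) * x))

  aᵤ-cong : aᵤ Preserves _≈_ ⟶ _≡_
  aᵤ-cong u≈v = cong -_ (∑-cong λ x →
    χ-cong (+-congˡ (x * x * x) (-‿cong (*-congʳ x (*-cong u≈v (+-congʳ (- + 1) u≈v))))))

  aᵤ-degenerate : ∀ {u} → u * (u - + 1) ≈ + 0 → aᵤ u ≡ + 0
  aᵤ-degenerate {u} u[u-1]≈0 = cong -_ (trans (∑-cong (λ x → trans (χ-cong (x³-0≈x³ x)) (χ-cube x))) ∑χ≡0)
    where
    x³-0≈x³ : ∀ x → x * x * x - u * (u - + 1) * x ≈ x * x * x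
    x³-0≈x³ x = ≈-trans (+-congˡ (x * x * x) (-‿cong (*-congʳ x u[u-1]≈0))) (≈-reflexive (ring (x * x * x) x))
      where
      ring : ∀ y x → y - + 0 * x ≡ y
      ring = solve-∀

  a[t]≡aᵤ : ∀ t → a[ t ] p ≡ aᵤ (+ 36 * + t + + 6)
  a[t]≡aᵤ t = cong -_ (begin
    sumℤ (map (λ x → χ (+ x * + x * + x - A-coef t * + x)) (upTo p))
      ≡⟨ sumℤ-map-applyUpTo p (λ x → χ (+ x * + x * + x - A-coef t * + x)) id ⟩
    sumUpTo p (λ x → χ (+ x * + x * + x - A-coef t * + x))
      ≡⟨ sumUpTo-cong {p} {λ x → χ (+ x * + x * + x - A-coef t * + x)} {λ x → χ (+ x * + x * + x - u * (u - + 1) * + x)}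
           (λ {x} _ → cong (λ c → χ (+ x * + x * + x - c * + x)) A-coef≡u[u-1]) ⟩
    sumUpTo p (λ x → χ (+ x * + x * + x - u * (u - + 1) * + x))
      ≡⟨ ∑≡sumUpTo (λ x → χ (x * x * x - u * (u - + 1) * x)) ⟨
    ∑ (λ x → χ (x * x * x - u * (u - + 1) * x)) ∎)
    where
    open ≡-Reasoning
    u = + 36 * + t + + 6
    A-coef≡u[u-1] : A-coef t ≡ u * (u - + 1)
    A-coef≡u[u-1] = trans (cong (λ c → (c + + 6) * (c + + 5)) (ℤP.pos-* 36 t)) (ring (+ 36 * + t))
      where
      ring : ∀ c → (c + + 6) * (c + + 5) ≡ (c + + 6) * ((c + + 6) - + 1)
      ring = solve-∀

  p∣Δ⇔ : ∀ t → (+ p) Unsigned.∣ Δ t ⇔ (+ 36 * + t + + 6 ≈ + 0 ⊎ + 36 * + t + + 6 ≈ + 1)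
  p∣Δ⇔ t = mk⇔ (p∣4uv⇒ ∘ p∣cube⇒p∣ ∘ subst (+ p ∣_) Δ≡[4uv]³ ∘ ∣ᵤ⇒∣)
               (∣⇒∣ᵤ ∘ subst (+ p ∣_) (sym Δ≡[4uv]³) ∘ ∣m⇒∣m*n w ∘ ∣m⇒∣m*n w ∘ ⇒p∣4uv)
    where
    u = + 36 * + t + + 6
    w = + 4 * u * (u - + 1)
    Δ≡[4uv]³ : Δ t ≡ (+ 4 * u * (u - + 1)) * (+ 4 * u * (u - + 1)) * (+ 4 * u * (u - + 1))
    Δ≡[4uv]³ = trans (cong (λ c → + 64 * ((c + + 6) * (c + + 6) * (c + + 6)) * ((c + + 5) * (c + + 5) * (c + + 5))) (ℤP.pos-* 36 t))
                     (ring (+ 36 * + t))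
      where
      ring : ∀ c → + 64 * ((c + + 6) * (c + + 6) * (c + + 6)) * ((c + + 5) * (c + + 5) * (c + + 5))
                   ≡ (+ 4 * (c + + 6) * ((c + + 6) - + 1)) * (+ 4 * (c + + 6) * ((c + + 6) - + 1)) * (+ 4 * (c + + 6) * ((c + + 6) - + 1))
      ring = solve-∀
    p∣4uv⇒ : + p ∣ + 4 * u * (u - + 1) → u ≈ + 0 ⊎ u ≈ + 1
    p∣4uv⇒ p∣4uv = Sum.map₁ (∣⇒≈0 ∘ [ ⊥-elim ∘ ¬p∣4 , id ] ∘ p∣*⇒p∣⊎p∣ (+ 4) u)
                            (Sum.map₂ mk≈ (p∣*⇒p∣⊎p∣ (+ 4 * u) (u - + 1) p∣4uv))
    ⇒p∣4uv : u ≈ + 0 ⊎ u ≈ + 1 → + p ∣ + 4 * u * (u - + 1)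
    ⇒p∣4uv = [ ∣m⇒∣m*n (u - + 1) ∘ ∣n⇒∣m*n (+ 4) ∘ ≈0⇒∣ , ∣n⇒∣m*n (+ 4 * u) ∘ m∣a-b ]

  𝟙[p∤Δ] : ∀ t → 𝟙 (¬? (divℤ? p (Δ t))) ≡ + 1 - 𝟙 (+ 36 * + t + + 6 ≈? + 0) - 𝟙 (+ 36 * + t + + 6 ≈? + 1)
  𝟙[p∤Δ] t = begin
    𝟙 (¬? (divℤ? p (Δ t)))          ≡⟨ 𝟙-¬? (divℤ? p (Δ t)) ⟩
    + 1 - 𝟙 (divℤ? p (Δ t))
      ≡⟨ cong (λ c → + 1 - c) (𝟙-disjoint-⊎ (u ≈? + 0) (u ≈? + 1) (divℤ? p (Δ t)) (p∣Δ⇔ t) 0≉1) ⟩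
    + 1 - (𝟙 (u ≈? + 0) + 𝟙 (u ≈? + 1)) ≡⟨ ring (𝟙 (u ≈? + 0)) (𝟙 (u ≈? + 1)) ⟩
    + 1 - 𝟙 (u ≈? + 0) - 𝟙 (u ≈? + 1) ∎
    where
    open ≡-Reasoning
    u = + 36 * + t + + 6
    0≉1 : u ≈ + 0 → ¬ u ≈ + 1
    0≉1 u≈0 u≈1 = ¬p∣-1 (m∣a-b (≈-trans (≈-sym u≈0) u≈1))
    ring : ∀ i j → + 1 - (i + j) ≡ + 1 - i - j
    ring = solve-∀

  A₁≡∑aᵤ : A₁ p ≡ ∑ aᵤ
  A₁≡∑aᵤ = begin
    A₁ p
      ≡⟨ sumℤ-map-filter (λ t → ¬? (divℤ? p (Δ t))) (λ t → a[ t ] p) (upTo p) ⟩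
    sumℤ (map (λ t → 𝟙 (¬? (divℤ? p (Δ t))) * a[ t ] p) (upTo p))
      ≡⟨ sumℤ-map-applyUpTo p (λ t → 𝟙 (¬? (divℤ? p (Δ t))) * a[ t ] p) id ⟩
    sumUpTo p (λ t → 𝟙 (¬? (divℤ? p (Δ t))) * a[ t ] p)
      ≡⟨ sumUpTo-cong {p} {λ t → 𝟙 (¬? (divℤ? p (Δ t))) * a[ t ] p} {λ t → G (+ 36 * + t + + 6)}
           (λ {t} _ → cong₂ _*_ (𝟙[p∤Δ] t) (a[t]≡aᵤ t)) ⟩
    sumUpTo p (λ t → G (+ 36 * + t + + 6))
      ≡⟨ ∑≡sumUpTo (λ z → G (+ 36 * z + + 6)) ⟨
    ∑ (λ z → G (+ 36 * z + + 6))
      ≡⟨ ∑-affine (+ 36) (+ 6) ¬p∣36 G-cong ⟩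
    ∑ G
      ≡⟨ ∑-cong (λ u → ring (𝟙 (u ≈? + 0)) (𝟙 (u ≈? + 1)) (aᵤ u)) ⟩
    ∑ (λ u → aᵤ u + - (𝟙 (u ≈? + 0) * aᵤ u) + - (𝟙 (u ≈? + 1) * aᵤ u))
      ≡⟨ trans (∑-+ _ _) (cong (_+ ∑ (λ u → - (𝟙 (u ≈? + 1) * aᵤ u))) (∑-+ _ _)) ⟩
    ∑ aᵤ + ∑ (λ u → - (𝟙 (u ≈? + 0) * aᵤ u)) + ∑ (λ u → - (𝟙 (u ≈? + 1) * aᵤ u))
      ≡⟨ cong₂ (λ x y → ∑ aᵤ + x + y) (−∑δaᵤ≡0 (+ 0) ≈-refl) (−∑δaᵤ≡0 (+ 1) ≈-refl) ⟩
    ∑ aᵤ + + 0 + + 0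
      ≡⟨ trans (ℤP.+-identityʳ _) (ℤP.+-identityʳ _) ⟩
    ∑ aᵤ ∎
    where
    open ≡-Reasoning
    G : ℤ → ℤ
    G u = (+ 1 - 𝟙 (u ≈? + 0) - 𝟙 (u ≈? + 1)) * aᵤ u
    G-cong : G Preserves _≈_ ⟶ _≡_
    G-cong u≈v = cong₂ _*_ (cong₂ (λ i j → + 1 - i - j) (𝟙-≈?-cong u≈v (≈-refl {+ 0})) (𝟙-≈?-cong u≈v (≈-refl {+ 1}))) (aᵤ-cong u≈v)
    ring : ∀ i j a → (+ 1 - i - j) * a ≡ a + - (i * a) + - (j * a)
    ring = solve-∀
    −∑δaᵤ≡0 : ∀ c → c * (c - + 1) ≈ + 0 → ∑ (λ u → - (𝟙 (u ≈? c) * aᵤ u)) ≡ + 0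
    −∑δaᵤ≡0 c c[c-1]≈0 = trans (sym (neg-distrib-∑ _)) (cong -_ (trans (∑-δ c aᵤ-cong) (aᵤ-degenerate {c} c[c-1]≈0)))

  ∑χ[x²-u²+u] : ∀ x → ∑ (λ u → χ (x * x - u * u + u)) ≡ χ (- + 1) * (+ p * 𝟙 (+ 4 * (x * x) + + 1 ≈? + 0) - + 1)
  ∑χ[x²-u²+u] x = begin
    ∑ (λ u → χ (x * x - u * u + u))
      ≡⟨ ∑-cong (λ u → trans (sym (χ-4* _)) (trans (cong χ (ring x u)) (χ-* (- + 1) _))) ⟩
    ∑ (λ u → χ (- + 1) * χ ((+ 2 * u + - + 1) * (+ 2 * u + - + 1) - D))
      ≡⟨ *-distribˡ-∑ (χ (- + 1)) _ ⟨
    χ (- + 1) * ∑ (λ u → χ ((+ 2 * u + - + 1) * (+ 2 * u + - + 1) - D))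
      ≡⟨ cong (χ (- + 1) *_) (∑-affine (+ 2) (- + 1) ¬p∣2 (λ w≈w′ → χ-cong (+-congʳ (- D) (*-cong w≈w′ w≈w′)))) ⟩
    χ (- + 1) * ∑ (λ w → χ (w * w - D))
      ≡⟨ cong (χ (- + 1) *_) (∑χ[x²-d] D) ⟩
    χ (- + 1) * (+ p * 𝟙 (D ≈? + 0) - + 1) ∎
    where
    open ≡-Reasoning
    D = + 4 * (x * x) + + 1
    ring : ∀ x u → + 4 * (x * x - u * u + u) ≡ - + 1 * ((+ 2 * u + - + 1) * (+ 2 * u + - + 1) - (+ 4 * (x * x) + + 1))
    ring = solve-∀

  ∑χ[4x²+1≈0] : ℤ
  ∑χ[4x²+1≈0] = ∑ (λ x → 𝟙 (+ 4 * (x * x) + + 1 ≈? + 0) * χ x)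

  ∑aᵤ≡-χ[-1]*p*∑χ[4x²+1≈0] : ∑ aᵤ ≡ - (χ (- + 1) * (+ p * ∑χ[4x²+1≈0]))
  ∑aᵤ≡-χ[-1]*p*∑χ[4x²+1≈0] = begin
    ∑ (λ u → - ∑ (λ x → χ (x * x * x - u * (u - + 1) * x)))
      ≡⟨ neg-distrib-∑ _ ⟨
    - ∑ (λ u → ∑ (λ x → χ (x * x * x - u * (u - + 1) * x)))
      ≡⟨ cong -_ (∑-comm _) ⟩
    - ∑ (λ x → ∑ (λ u → χ (x * x * x - u * (u - + 1) * x)))
      ≡⟨ cong -_ (∑-cong λ x → trans (∑-cong (λ u → trans (cong χ (ring₁ x u)) (χ-* x _)))
                                     (sym (*-distribˡ-∑ (χ x) _))) ⟩
    - ∑ (λ x → χ x * ∑ (λ u → χ (x * x - u * u + u)))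
      ≡⟨ cong -_ (∑-cong λ x → trans (cong (χ x *_) (∑χ[x²-u²+u] x))
                                     (ring₂ (χ x) c (+ p) (𝟙 (+ 4 * (x * x) + + 1 ≈? + 0)))) ⟩
    - ∑ (λ x → c * + p * (𝟙 (+ 4 * (x * x) + + 1 ≈? + 0) * χ x) + - c * χ x)
      ≡⟨ cong -_ (∑-+ _ _) ⟩
    - (∑ (λ x → c * + p * (𝟙 (+ 4 * (x * x) + + 1 ≈? + 0) * χ x)) + ∑ (λ x → - c * χ x))
      ≡⟨ cong -_ (cong₂ _+_ (sym (*-distribˡ-∑ (c * + p) _)) (trans (sym (*-distribˡ-∑ (- c) χ)) (cong (- c *_) ∑χ≡0))) ⟩
    - (c * + p * ∑χ[4x²+1≈0] + - c * + 0)
      ≡⟨ cong -_ (ring₃ c (+ p) ∑χ[4x²+1≈0]) ⟩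
    - (c * (+ p * ∑χ[4x²+1≈0])) ∎
    where
    open ≡-Reasoning
    c = χ (- + 1)
    ring₁ : ∀ x u → x * x * x - u * (u - + 1) * x ≡ x * (x * x - u * u + u)
    ring₁ = solve-∀
    ring₂ : ∀ χx c p i → χx * (c * (p * i - + 1)) ≡ c * p * (i * χx) + - c * χx
    ring₂ = solve-∀
    ring₃ : ∀ c p w → c * p * w + - c * + 0 ≡ c * (p * w)
    ring₃ = solve-∀

  ∑χ[4x²+1≈0]≡0 : ¬ IsSquare (- + 1) → ∑χ[4x²+1≈0] ≡ + 0
  ∑χ[4x²+1≈0]≡0 ¬sq = trans (∑-cong (λ x → cong (_* χ x) (𝟙-no (_ ≈? + 0) (¬sq ∘ [2x]²≈-1 x))))
                  (trans (∑-const (+ 0)) (ℤP.*-zeroʳ (+ p)))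
    where
    [2x]²≈-1 : ∀ x → + 4 * (x * x) + + 1 ≈ + 0 → IsSquare (- + 1)
    [2x]²≈-1 x D≈0 = + 2 * x , ≈-trans (≈-reflexive (ring x)) (+-congʳ (- + 1) D≈0)
      where
      ring : ∀ x → + 2 * x * (+ 2 * x) ≡ + 4 * (x * x) + + 1 - + 1
      ring = solve-∀

  IsSquare[2i] : ∀ {i} → i * i ≈ - + 1 → IsSquare (+ 2 * i)
  IsSquare[2i] {i} ii≈-1 = + 1 + i , (begin
    (+ 1 + i) * (+ 1 + i)    ≡⟨ ring i ⟩
    + 2 * i + (i * i + + 1)  ≈⟨ +-congˡ (+ 2 * i) (+-congʳ (+ 1) ii≈-1) ⟩
    + 2 * i + + 0            ≡⟨ ℤP.+-identityʳ (+ 2 * i) ⟩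
    + 2 * i                  ∎)
    where
    open ≈-Reasoning ≈-setoid
    ring : ∀ i → (+ 1 + i) * (+ 1 + i) ≡ + 2 * i + (i * i + + 1)
    ring = solve-∀

  -- The roots of 4x² + 1 are given by 2x = ±i, and χ(x) = χ(2 · 2x).
  ∑χ[4x²+1≈0]≡2 : IsSquare (- + 1) → ∑χ[4x²+1≈0] ≡ + 2
  ∑χ[4x²+1≈0]≡2 (i , ii≈-1) = begin
    ∑ (λ x → 𝟙 (+ 4 * (x * x) + + 1 ≈? + 0) * χ x)
      ≡⟨ ∑-cong (λ x → cong₂ _*_ (𝟙-cong (+ 4 * (x * x) + + 1 ≈? + 0) ((+ 2 * x + + 0) * (+ 2 * x + + 0) ≈? i * i)
                                         (D≈0⇔[2x]²≈ii x))
                                 (trans (sym (χ-4* x)) (cong χ (ring x)))) ⟩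
    ∑ (λ x → G (+ 2 * x + + 0))
      ≡⟨ ∑-affine (+ 2) (+ 0) ¬p∣2 G-cong ⟩
    ∑ G
      ≡⟨ ∑-cong (λ y → trans (cong (_* χ (+ 2 * y)) (𝟙-square-roots ¬p∣i y))
                             (ℤP.*-distribʳ-+ (χ (+ 2 * y)) (𝟙 (y ≈? i)) _)) ⟩
    ∑ (λ y → 𝟙 (y ≈? i) * χ (+ 2 * y) + 𝟙 (y ≈? - i) * χ (+ 2 * y))
      ≡⟨ ∑-+ _ _ ⟩
    ∑ (λ y → 𝟙 (y ≈? i) * χ (+ 2 * y)) + ∑ (λ y → 𝟙 (y ≈? - i) * χ (+ 2 * y))
      ≡⟨ cong₂ _+_ (∑-δ i χ[2*]-cong) (∑-δ (- i) χ[2*]-cong) ⟩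
    χ (+ 2 * i) + χ (+ 2 * - i)
      ≡⟨ cong₂ _+_ (χ-square (¬p∣* ¬p∣2 ¬p∣i) (IsSquare[2i] ii≈-1))
                   (χ-square (¬p∣* ¬p∣2 (¬p∣- ¬p∣i)) (IsSquare[2i] [-i][-i]≈-1)) ⟩
    + 2 ∎
    where
    open ≡-Reasoning
    ¬p∣i : ¬ + p ∣ i
    ¬p∣i p∣i = ¬p∣-1 (∣-resp-≈ ii≈-1 (∣n⇒∣m*n i p∣i))
    [-i][-i]≈-1 : - i * - i ≈ - + 1
    [-i][-i]≈-1 = ≈-trans (≈-reflexive (ring′ i)) ii≈-1
      where
      ring′ : ∀ i → - i * - i ≡ i * i
      ring′ = solve-∀
    G : ℤ → ℤ
    G y = 𝟙 (y * y ≈? i * i) * χ (+ 2 * y)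
    χ[2*]-cong : (λ y → χ (+ 2 * y)) Preserves _≈_ ⟶ _≡_
    χ[2*]-cong = χ-cong ∘ *-congˡ (+ 2)
    G-cong : G Preserves _≈_ ⟶ _≡_
    G-cong y≈y′ = cong₂ _*_ (𝟙-≈?-cong (*-cong y≈y′ y≈y′) (≈-refl {i * i})) (χ[2*]-cong y≈y′)
    ring : ∀ x → + 4 * x ≡ + 2 * (+ 2 * x + + 0)
    ring = solve-∀
    D≈0⇔[2x]²≈ii : ∀ x → + 4 * (x * x) + + 1 ≈ + 0 ⇔ (+ 2 * x + + 0) * (+ 2 * x + + 0) ≈ i * i
    D≈0⇔[2x]²≈ii x = mk⇔
      (λ D≈0 → ≈-trans (≈-reflexive (ring₁ x)) (≈-trans (+-congʳ (- + 1) D≈0) (≈-sym ii≈-1)))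
      (λ [2x]²≈ii → ≈-trans (≈-reflexive (ring₂ x)) (+-congʳ (+ 1) (≈-trans [2x]²≈ii ii≈-1)))
      where
      ring₁ : ∀ x → (+ 2 * x + + 0) * (+ 2 * x + + 0) ≡ + 4 * (x * x) + + 1 - + 1
      ring₁ = solve-∀
      ring₂ : ∀ x → + 4 * (x * x) + + 1 ≡ (+ 2 * x + + 0) * (+ 2 * x + + 0) + + 1
      ring₂ = solve-∀

  A₁-when-p≡1[4] : p % 4 ≡ 1 → A₁ p ≡ - (+ 2 * + p)
  A₁-when-p≡1[4] p%4≡1 = begin
    A₁ p                              ≡⟨ trans A₁≡∑aᵤ ∑aᵤ≡-χ[-1]*p*∑χ[4x²+1≈0] ⟩
    - (χ (- + 1) * (+ p * ∑χ[4x²+1≈0]))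
      ≡⟨ cong₂ (λ c w → - (c * (+ p * w))) (χ-square ¬p∣-1 sq) (∑χ[4x²+1≈0]≡2 sq) ⟩
    - (+ 1 * (+ p * + 2))             ≡⟨ cong -_ (ring (+ p)) ⟩
    - (+ 2 * + p)                     ∎
    where
    open ≡-Reasoning
    sq = Equivalence.from IsSquare[-1]⇔p%4≡1 p%4≡1
    ring : ∀ p → + 1 * (p * + 2) ≡ + 2 * p
    ring = solve-∀

  A₁-when-p≢1[4] : p % 4 ≢ 1 → A₁ p ≡ + 0
  A₁-when-p≢1[4] p%4≢1 = begin
    A₁ p                              ≡⟨ trans A₁≡∑aᵤ ∑aᵤ≡-χ[-1]*p*∑χ[4x²+1≈0] ⟩
    - (χ (- + 1) * (+ p * ∑χ[4x²+1≈0]))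
      ≡⟨ cong (λ w → - (χ (- + 1) * (+ p * w))) (∑χ[4x²+1≈0]≡0 (p%4≢1 ∘ Equivalence.to IsSquare[-1]⇔p%4≡1)) ⟩
    - (χ (- + 1) * (+ p * + 0))       ≡⟨ ring (χ (- + 1)) (+ p) ⟩
    + 0                               ∎
    where
    open ≡-Reasoning
    ring : ∀ c p → - (c * (p * + 0)) ≡ + 0
    ring = solve-∀

lemmaB6 : (p : ℕ) .{{_ : NonZero p}} → Prime p →
    (p % 4 ≡ 1 → A₁ p ≡ - (+ 2 * + p)) × (p % 4 ≢ 1 → A₁ p ≡ + 0)
-- For p = 2, 3 every Δ(t) is divisible by p, so A₁ p = 0 by evaluation.
lemmaB6 2 _ = (λ ()) , (λ _ → refl)
lemmaB6 3 _ = (λ ()) , (λ _ → refl)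
lemmaB6 4 4-prime = ⊥-elim (Dec.toWitnessFalse {a? = prime? 4} _ 4-prime)
lemmaB6 p@(ℕ.suc (ℕ.suc (ℕ.suc (ℕ.suc (ℕ.suc _))))) p-prime = A₁-when-p≡1[4] , A₁-when-p≢1[4]
  where open Family p p-prime (ℕ.s≤s (ℕ.s≤s (ℕ.s≤s (ℕ.s≤s (ℕ.s≤s ℕ.z≤n)))))
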